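{- Fix $g\ge 1$ and let $\mathcal{M}^g$ be the set of maps of genus $g$ all of whose faces have even degree. The mapping $\Phi$ is an involution on the set of triples $(\mathbf{m},\boldsymbol{\gamma},\varepsilon)$ where $\mathbf{m}\in\mathcal{M}^g$, $\boldsymbol{\gamma}$ is a noncontractible simple loop of $\mathbf{m}$, and $\varepsilon\in\{+,-\}$. Moreover, if $\Phi(\mathbf{m},\boldsymbol{\gamma},\varepsilon)=(\tilde{\mathbf{m}},\tilde{\boldsymbol{\gamma}},\tilde\varepsilon)$, then $\tilde{\mathbf{m}}$ has the same number of edges as $\mathbf{m}$, and, when the faces of $\mathbf{m}$ are labeled, $\tilde{\mathbf{m}}$ (with inherited labels) has the same type as $\mathbf{m}$.
   Context: A map is a cellular embedding of a finite connected graph (multiple edges and loops allowed) into a compact orientable surface, up to homeomorphism, with a distinguished corner (the root). The type of a map with faces labeled $f_1,\dots,f_r$ is $(\deg f_1,\dots,\deg f_r)$. A half-edge is an edge with an orientation, from its tail $e^-$ to its head $e^+$. A path is a sequence $(e_1,\dots,e_k)$ of half-edges with $e_i^+=e_{i+1}^-$; its length is $k$. A loop is a path with $e_k^+=e_1^-$; it is simple if $(e_1,\dots,e_{k-1})$ visits pairwise distinct vertices; it is noncontractible if the closed curve on the surface traced by its half-edges is not null-homotopic. Definition of $\Phi$: given $\mathbf{m}$, a noncontractible simple loop $\boldsymbol{\gamma}=(\gamma_1,\dots,\gamma_k)$ and $\varepsilon\in\{+,-\}$: (1) cut the surface along $\boldsymbol{\gamma}$, obtaining a surface with two boundary components, one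 carrying the left copy $\boldsymbol{\gamma}^\ell=(\gamma^\ell_1,\dots,\gamma^\ell_k)$ of $\boldsymbol{\gamma}$ and the other its right copy $\boldsymbol{\gamma}^r=(\gamma^r_1,\dots,\gamma^r_k)$; (2) glue back by identifying, for each $1\le i\le k$, $\gamma^r_i$ with $\gamma^\ell_{i+1}$ if $\varepsilon=+$, resp. with $\gamma^\ell_{i-1}$ if $\varepsilon=-$ (indices modulo $k$); denote by $\gamma^r_i\Join\gamma^\ell_{i\pm1}$ the resulting half-edge. The result is a map $\tilde{\mathbf{m}}$ (root and face labels inherited from $\mathbf{m}$), with loop $\tilde{\boldsymbol{\gamma}}=(\gamma^r_1\Join\gamma^\ell_{1\pm1},\dots,\gamma^r_k\Join\gamma^\ell_{k\pm1})$, and $\tilde\varepsilon=-\varepsilon$. Then $\Phi(\mathbf{m},\boldsymbol{\gamma},\varepsilon):=(\tilde{\mathbf{m}},\tilde{\boldsymbol{\gamma}},\tilde\varepsilon)$. -}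

module Defs where

open import Data.Nat using (ℕ; zero; suc; _+_; _*_; _≤_; _≤ᵇ_)
open import Data.Nat.Divisibility using (_∣_)
open import Data.Nat.DivMod using (_%_; m%n<n)
open import Data.Bool using (Bool; true; false)
import Data.Fin as Fin
open import Data.Fin using (Fin; toℕ; fromℕ<; cast)
open import Data.Bool.ListAction using (any; all)
open import Data.Fin.Properties using () renaming (_≟_ to _≟ᶠ_)
open import Data.List using (List; []; _∷_; _++_; map; upTo; allFin; length; filter)
open import Data.Maybe using (Maybe; just; nothing)
import Data.Maybe as Maybe
open import Data.Product using (Σ; ∃; _×_; _,_)
open import Data.Sum using (_⊎_)
open import Data.Unit using (⊤)
open import Relation.Nullary using (¬_; yes; no; does)
open import Relation.Binary.PropositionalEquality using (_≡_; cong)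
open import Function using (_∘_)

-- Darts (half-edges) are Fin D.  σ is the counterclockwise rotation of
-- the half-edges around their tail vertex, α reverses a half-edge.
-- A corner is labelled by the dart d such that the corner lies between
-- d and σ d (counterclockwise).  The root is such a corner label.

record RawMap (D : ℕ) : Set where
  field
    σ    : Fin D → Fin D
    α    : Fin D → Fin D
    root : Fin D
open RawMap public

iter : {A : Set} → (A → A) → ℕ → A → A
iter f zero    x = x
iter f (suc n) x = f (iter f n x)

IsPerm : {A : Set} → (A → A) → Set
IsPerm {A} f = Σ (A → A) λ g → (∀ x → g (f x) ≡ x) × (∀ x → f (g x) ≡ x)

data Reach {D : ℕ} (m : RawMap D) : Fin D → Fin D → Set where
  here  : ∀ {d} → Reach m d d
  viaσ  : ∀ {d e} → Reach m (σ m d) e → Reach m d e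
  viaα  : ∀ {d e} → Reach m (α m d) e → Reach m d e

record IsMap {D : ℕ} (m : RawMap D) : Set where
  field
    σ-perm      : IsPerm (σ m)
    α-invol     : ∀ d → α m (α m d) ≡ d
    α-fpf       : ∀ d → ¬ (α m d ≡ d)
    connected   : ∀ d e → Reach m d e

-- face permutation: the corner (d, σ d) is followed, along its face,
-- by the corner (α (σ d), σ (α (σ d)))
φ : {D : ℕ} → RawMap D → Fin D → Fin D
φ m = α m ∘ σ m

orbitList : {D : ℕ} → (Fin D → Fin D) → Fin D → List (Fin D)
orbitList {D} f d = map (λ j → iter f j d) (upTo D)

_==_ : {D : ℕ} → Fin D → Fin D → Bool
x == y = does (x ≟ᶠ y)

_≤ᵇᶠ_ : {D : ℕ} → Fin D → Fin D → Bool
x ≤ᵇᶠ y = toℕ x ≤ᵇ toℕ y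

inOrbit : {D : ℕ} → (Fin D → Fin D) → Fin D → Fin D → Bool
inOrbit f d e = any (_== e) (orbitList f d)

orbitSize : {D : ℕ} → (Fin D → Fin D) → Fin D → ℕ
orbitSize {D} f d = length (filter (λ e → inOrbit f d e ≟ᵇ true) (allFin D))
  where
  open import Data.Bool using () renaming (_≟_ to _≟ᵇ_)

numOrbits : {D : ℕ} → (Fin D → Fin D) → ℕ
numOrbits {D} f =
  length (filter (λ d → all (d ≤ᵇᶠ_) (orbitList f d) ≟ᵇ true) (allFin D))
  where
  open import Data.Bool using () renaming (_≟_ to _≟ᵇ_)

numVertices numEdges numFaces : {D : ℕ} → RawMap D → ℕ
numVertices m = numOrbits (σ m)
numEdges    m = numOrbits (α m)
numFaces    m = numOrbits (φ m)

faceDeg : {D : ℕ} → RawMap D → Fin D → ℕ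
faceDeg m d = orbitSize (φ m) d

-- genus via Euler's formula  V - E + F = 2 - 2g
HasGenus : {D : ℕ} → RawMap D → ℕ → Set
HasGenus m g = numVertices m + numFaces m + 2 * g ≡ numEdges m + 2

InMg : ℕ → {D : ℕ} → RawMap D → Set
InMg g m = IsMap m × HasGenus m g × (∀ d → 2 ∣ faceDeg m d)

SameVertex : {D : ℕ} → RawMap D → Fin D → Fin D → Set
SameVertex m d e = ∃ λ j → iter (σ m) j d ≡ e

SameFace : {D : ℕ} → RawMap D → Fin D → Fin D → Set
SameFace m d e = ∃ λ j → iter (φ m) j d ≡ e

-- the tail of a dart d is its vertex; its head is the vertex of α d
lastOf : {A : Set} → A → List A → A
lastOf x []       = x
lastOf x (y ∷ ys) = lastOf y ys

Chain : {D : ℕ} → RawMap D → List (Fin D) → Set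
Chain m []           = ⊤
Chain m (x ∷ [])     = ⊤
Chain m (x ∷ y ∷ ys) = SameVertex m (α m x) y × Chain m (y ∷ ys)

ClosedPath : {D : ℕ} → RawMap D → List (Fin D) → Set
ClosedPath m []       = ⊤
ClosedPath m (x ∷ xs) = Chain m (x ∷ xs) × SameVertex m (α m (lastOf x xs)) x

-- boundary walk of the face containing the corner d, starting at the
-- tail of d
faceWalk : {D : ℕ} → RawMap D → Fin D → List (Fin D)
faceWalk m d = map (λ j → σ m (iter (φ m) j d)) (upTo (faceDeg m d))

data Elementary {D : ℕ} (m : RawMap D) : List (Fin D) → Set where
  backtrack : ∀ e → Elementary m (e ∷ α m e ∷ [])
  face      : ∀ d → Elementary m (faceWalk m d)

data HStep {D : ℕ} (m : RawMap D) : List (Fin D) → List (Fin D) → Set where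
  delete : ∀ w₁ X w₂ → Elementary m X → ClosedPath m (w₁ ++ X ++ w₂) →
           HStep m (w₁ ++ X ++ w₂) (w₁ ++ w₂)

data Homotopic {D : ℕ} (m : RawMap D) : List (Fin D) → List (Fin D) → Set where
  h-step  : ∀ {u v} → HStep m u v → Homotopic m u v
  h-refl  : ∀ {u} → Homotopic m u u
  h-sym   : ∀ {u v} → Homotopic m u v → Homotopic m v u
  h-trans : ∀ {u v w} → Homotopic m u v → Homotopic m v w → Homotopic m u w

-- a loop (γ₁,…,γ_k), k = len + 1 ≥ 1, indexed by Fin (suc len)
record Loop (D : ℕ) : Set where
  field
    len   : ℕ
    darts : Fin (suc len) → Fin D
open Loop public

rot : {n : ℕ} → ℕ → Fin (suc n) → Fin (suc n)
rot {n} j i = fromℕ< (m%n<n (toℕ i + j) (suc n))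

loopList : {D : ℕ} → Loop D → List (Fin D)
loopList γ = map (darts γ) (allFin (suc (len γ)))

IsLoop : {D : ℕ} → RawMap D → Loop D → Set
IsLoop m γ = ∀ i → SameVertex m (α m (darts γ i)) (darts γ (rot 1 i))

IsSimple : {D : ℕ} → RawMap D → Loop D → Set
IsSimple m γ = ∀ i j → SameVertex m (darts γ i) (darts γ j) → i ≡ j

Noncontractible : {D : ℕ} → RawMap D → Loop D → Set
Noncontractible m γ = ¬ Homotopic m (loopList γ) []

data Sign : Set where
  plus minus : Sign

neg : Sign → Sign
neg plus  = minus
neg minus = plus

shift : {n : ℕ} → Sign → Fin (suc n) → Fin (suc n)
shift       plus  = rot 1
shift {n}   minus = rot n

record Triple (D : ℕ) : Set where
  constructor ⟨_,_,_⟩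
  field
    tmap  : RawMap D
    tloop : Loop D
    tsign : Sign
open Triple public

ValidTriple : ℕ → {D : ℕ} → Triple D → Set
ValidTriple g ⟨ m , γ , ε ⟩ =
  InMg g m × IsLoop m γ × IsSimple m γ × Noncontractible m γ

findIn : {D k : ℕ} → (Fin k → Fin D) → Fin D → Maybe (Fin k)
findIn {k = zero}  f d = nothing
findIn {k = suc k} f d with f Fin.zero ≟ᶠ d
... | yes _ = just Fin.zero
... | no  _ = Maybe.map Fin.suc (findIn (f ∘ Fin.suc) d)

module _ {D : ℕ} (m : RawMap D) (γ : Loop D) (ε : Sign) where
  private
    k' = len γ
    out : Fin (suc k') → Fin D
    out = darts γ
    -- the half-edge pointing from γᵢ⁻ back along γ_{i-1}
    inn : Fin (suc k') → Fin D
    inn i = α m (out (shift minus i))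
    τ : Fin D → Fin D
    τ d with findIn out d
    ... | just i  = σ m (out (shift ε i))
    ... | nothing = σ m d

  -- Cutting along γ and regluing γʳᵢ with γˡ_{i±1}.  Half-edges are kept
  -- (γʳᵢ ⋈ γˡ_{i±1} is named by the dart γᵢ); the new vertex
  -- vʳᵢ ⋈ vˡ_{i±1} has counterclockwise rotation
  --   γᵢ , (left darts of v_{i±1}) , inn i , (right darts of vᵢ).
  Φσ : Fin D → Fin D
  Φσ d with findIn inn (τ d)
  ... | just j  = inn (shift (neg ε) j)
  ... | nothing = τ d

  -- correspondence of corners of m with corners of m̃: only the left corner
  -- (γᵢ, σ γᵢ) changes its label, to (γ_{i∓1}, σ̃ γ_{i∓1})
  cornerMap : Fin D → Fin D
  cornerMap d with findIn out d
  ... | just i  = out (shift (neg ε) i)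
  ... | nothing = d

  Φmap : RawMap D
  Φmap = record { σ = Φσ ; α = α m ; root = cornerMap (root m) }

Φ : {D : ℕ} → Triple D → Triple D
Φ ⟨ m , γ , ε ⟩ = ⟨ Φmap m γ ε , γ , neg ε ⟩

-- isomorphism of triples (maps are considered up to homeomorphism,
-- i.e. up to relabelling of darts preserving all the structure)
record TripleIso {D : ℕ} (x y : Triple D) : Set where
  field
    π      : Fin D → Fin D
    π-perm : IsPerm π
    π-σ    : ∀ d → π (σ (tmap x) d) ≡ σ (tmap y) (π d)
    π-α    : ∀ d → π (α (tmap x) d) ≡ α (tmap y) (π d)
    π-root : π (root (tmap x)) ≡ root (tmap y)
    π-len  : len (tloop x) ≡ len (tloop y)
    π-loop : ∀ i → π (darts (tloop x) i) ≡ darts (tloop y) (cast (cong suc π-len) i)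
    π-sign : tsign x ≡ tsign y

ρ : {D : ℕ} → Triple D → Fin D → Fin D
ρ ⟨ m , γ , ε ⟩ = cornerMap m γ ε

-- Let out = (γ₁,…,γ_k) and inn = (γ_k⁻¹, γ₁⁻¹, …, γ_{k-1}⁻¹) list the two darts of γ at each of its vertices.
-- The rotation of the reglued map is σ̃ = cycleAlong inn (-ε) ∘ σ ∘ cycleAlong out ε, where cycleAlong f s
-- moves f i to f (i ± 1) and fixes all other darts; regluing (M̃, γ, -ε) therefore gives σ back, so Φ is an
-- involution, while α, hence every edge, is untouched. The face permutation α σ̃ is conjugate to α σ by
-- cycleAlong out (-ε), which is exactly the inherited labelling of corners, so faces and their degrees are
-- preserved. Vertices away from γ do not change, and the vertex v_i of γ is replaced by one vertex made of
-- γ_i, the darts on the right of γ at v_i and those on the left at v_{i±1}; hence the number of vertices, the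
-- genus and the simplicity of γ are preserved. Finally, a walk of M translates into a walk of M̃, with an
-- extra step along γ wherever a dart changed vertex; the translation respects elementary homotopies and fixes
-- γ, and applied to (M̃, γ, -ε) it shows that γ stays noncontractible.

module Submission where

open import Defs
open import Agda.Primitive using (lzero)
open import Data.Bool using (true; T)
import Data.Bool as Bool
open import Data.Bool.ListAction using (any; all)
open import Data.Bool.Properties using (T-≡)
open import Data.Empty using (⊥; ⊥-elim)
open import Data.Fin using (Fin; toℕ)
import Data.Fin as Fin
import Data.Fin.Properties as Finₚ
open import Data.List using (List; []; _∷_; _++_; map; upTo; allFin; length; filter; lookup)
open import Data.List.Membership.Propositional using (_∈_)
open import Data.List.Membership.Propositional.Properties
  using (∈-lookup; ∈-allFin; ∈-filter⁺; ∈-filter⁻; ∈-map⁺; ∈-map⁻; ∈-upTo⁺; ∈-upTo⁻)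
open import Data.List.Properties
  using (length-map; length-upTo; map-cong; filter-≐; map-++; ++-assoc; ++-identityʳ; applyUpTo-∷ʳ)
import Data.List.Relation.Unary.All as All
open import Data.List.Relation.Unary.All.Properties using (all⁺; all⁻)
open import Data.List.Relation.Unary.AllPairs using (_∷_)
open import Data.List.Relation.Unary.Any using (index)
import Data.List.Relation.Unary.Any as Any
open import Data.List.Relation.Unary.Any.Properties using (any⁺; any⁻; lookup-index)
open import Data.List.Relation.Unary.Unique.Propositional using (Unique)
import Data.List.Relation.Unary.Unique.Propositional.Properties as Uniqueₚ
open import Data.Maybe using (Maybe; just; nothing; maybe′)
open import Data.Maybe.Properties using (just-injective)
open import Data.Nat using (ℕ; zero; suc; _+_; _*_; _∸_; _<_; _≤_; z≤n; s≤s)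
open import Data.Nat.Divisibility using (_∣_)
open import Data.Nat.DivMod
  using (_%_; _/_; m%n<n; m≡m%n+[m/n]*n; %-distribˡ-+; m%n%n≡m%n; [m+n]%n≡m%n; m<n⇒m%n≡m)
open import Data.Nat.Properties
open import Data.List.Extrema ≤-totalOrder using (argmin; argmin-sel; f[argmin]≤f[xs])
open import Data.Product using (∃; _×_; _,_; proj₁; proj₂)
open import Data.Sum using (_⊎_; inj₁; inj₂; [_,_])
open import Data.Unit using (tt)
open import Function using (id; _∘_; case_of_; _⟨_⟩_)
open import Function.Bundles using (_⇔_; Equivalence; mk⇔)
open import Function.Definitions using (Injective)
open import Relation.Binary.Bundles using (Setoid)
open import Relation.Binary.Definitions using (tri<; tri≈; tri>)
open import Relation.Binary.PropositionalEquality
  using (_≡_; _≢_; refl; sym; trans; cong; cong₂; subst; subst₂; module ≡-Reasoning)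
import Relation.Binary.Reasoning.Setoid as Reasoning
open import Relation.Nullary using (¬_; Dec; yes; no)
open import Relation.Nullary.Decidable using (_×-dec_)
open import Relation.Unary using (Pred; Decidable)

-- Iterates and orbits

Orb : {A : Set} → (A → A) → A → A → Set
Orb f d e = ∃ λ j → iter f j d ≡ e

module _ {A : Set} where

  iter-+ : (f : A → A) (m n : ℕ) (x : A) → iter f (m + n) x ≡ iter f m (iter f n x)
  iter-+ f zero    n x = refl
  iter-+ f (suc m) n x = cong f (iter-+ f m n x)

  iter-periodic : (f : A → A) {p : ℕ} {x : A} → iter f p x ≡ x → ∀ q → iter f (q * p) x ≡ x
  iter-periodic f         e zero    = refl
  iter-periodic f {p} {x} e (suc q) =
    trans (iter-+ f p (q * p) x) (trans (cong (iter f p) (iter-periodic f e q)) e)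

  iter-mod : (f : A → A) {p : ℕ} {x : A} → iter f (suc p) x ≡ x → ∀ j → iter f (j % suc p) x ≡ iter f j x
  iter-mod f {p} {x} e j = begin
    iter f (j % suc p) x                               ≡⟨ cong (iter f (j % suc p)) (sym (iter-periodic f e (j / suc p))) ⟩
    iter f (j % suc p) (iter f (j / suc p * suc p) x)  ≡⟨ sym (iter-+ f (j % suc p) (j / suc p * suc p) x) ⟩
    iter f (j % suc p + j / suc p * suc p) x           ≡⟨ cong (λ z → iter f z x) (sym (m≡m%n+[m/n]*n j (suc p))) ⟩
    iter f j x                                         ∎
    where open ≡-Reasoning

  iter-conj : {B : Set} {f : A → A} {g : B → B} (h : A → B) →
    (∀ x → h (f x) ≡ g (h x)) → ∀ n x → h (iter f n x) ≡ iter g n (h x)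
  iter-conj h comm zero    x = refl
  iter-conj {g = g} h comm (suc n) x = trans (comm _) (cong g (iter-conj h comm n x))

  iter-cong : {f g : A → A} → (∀ x → f x ≡ g x) → ∀ n x → iter f n x ≡ iter g n x
  iter-cong = iter-conj (λ x → x)

  iter-commute : (f : A → A) (n : ℕ) (x : A) → iter f n (f x) ≡ f (iter f n x)
  iter-commute f n x = sym (iter-conj f (λ _ → refl) n x)

  IsPerm⇒injective : {f : A → A} → IsPerm f → Injective _≡_ _≡_ f
  IsPerm⇒injective (g , g∘f , _) {a} {b} e = trans (sym (g∘f a)) (trans (cong g e) (g∘f b))

  iter-injective : {f : A → A} → IsPerm f → ∀ n → Injective _≡_ _≡_ (iter f n)
  iter-injective P zero    e = e
  iter-injective P (suc n) e = iter-injective P n (IsPerm⇒injective P e)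

  IsPerm-∘ : {f g : A → A} → IsPerm f → IsPerm g → IsPerm (f ∘ g)
  IsPerm-∘ {f} {g} (f⁻¹ , fl , fr) (g⁻¹ , gl , gr) =
    g⁻¹ ∘ f⁻¹ , (λ x → trans (cong g⁻¹ (fl (g x))) (gl x)) , (λ x → trans (cong f (gr (f⁻¹ x))) (fr x))

  IsPerm-cong : {f g : A → A} → (∀ x → f x ≡ g x) → IsPerm f → IsPerm g
  IsPerm-cong f≗g (f⁻¹ , l , r) =
    f⁻¹ , (λ x → trans (cong f⁻¹ (sym (f≗g x))) (l x)) , (λ x → trans (sym (f≗g (f⁻¹ x))) (r x))

  Orb-refl : {f : A → A} {d : A} → Orb f d d
  Orb-refl = 0 , refl

  Orb-trans : {f : A → A} {a b c : A} → Orb f a b → Orb f b c → Orb f a c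
  Orb-trans {f} {a} (i , refl) (j , refl) = j + i , iter-+ f j i a

  Orb-conj : {B : Set} {f : A → A} {g : B → B} (h : A → B) →
    (∀ x → h (f x) ≡ g (h x)) → ∀ {d e} → Orb f d e → Orb g (h d) (h e)
  Orb-conj h comm (j , refl) = j , sym (iter-conj h comm j _)

module _ {P : ℕ → Set} (P? : ∀ n → Dec (P n)) where

  Least : ℕ → Set
  Least n = P n × (∀ m → m < n → ¬ P m)

  least-or-none : ∀ k → (∃ Least) ⊎ (∀ m → m < k → ¬ P m)
  least-or-none zero = inj₂ (λ m ())
  least-or-none (suc k) with least-or-none k
  ... | inj₁ found = inj₁ found
  ... | inj₂ none with P? k
  ...   | yes pk = inj₁ (k , pk , none)
  ...   | no ¬pk = inj₂ λ m m<1+k → [ none m , (λ { refl → ¬pk }) ] (m<1+n⇒m<n∨m≡n m<1+k)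

  least : ∀ N → P N → ∃ Least
  least N pN = [ id , (λ none → ⊥-elim (none N (n<1+n N) pN)) ] (least-or-none (suc N))

length-≤-injection : {A B : Set} {xs : List A} (ys : List B) → Unique xs → (h : A → B) →
  (∀ {x} → x ∈ xs → h x ∈ ys) → (∀ {x y} → x ∈ xs → y ∈ xs → h x ≡ h y → x ≡ y) →
  length xs ≤ length ys
length-≤-injection {xs = xs} ys xs! h h∈ys h-inj = Finₚ.injective⇒≤ index∘h-injective
  where
  lookup-injective : ∀ {zs : List _} → Unique zs → ∀ {i j} → lookup zs i ≡ lookup zs j → i ≡ j
  lookup-injective (_  ∷ _)   {Fin.zero}  {Fin.zero}  _ = refl
  lookup-injective (x∉ ∷ _)   {Fin.zero}  {Fin.suc j} e = ⊥-elim (All.lookup x∉ (∈-lookup j) e)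
  lookup-injective (x∉ ∷ _)   {Fin.suc i} {Fin.zero}  e = ⊥-elim (All.lookup x∉ (∈-lookup i) (sym e))
  lookup-injective (_  ∷ zs!) {Fin.suc i} {Fin.suc j} e = cong Fin.suc (lookup-injective zs! e)

  index∘h : Fin (length xs) → Fin (length ys)
  index∘h i = index (h∈ys (∈-lookup i))

  index∘h-injective : Injective _≡_ _≡_ index∘h
  index∘h-injective {i} {j} e = lookup-injective xs! (h-inj (∈-lookup i) (∈-lookup j)
    (trans (lookup-index (h∈ys (∈-lookup i)))
      (trans (cong (lookup ys) e) (sym (lookup-index (h∈ys (∈-lookup j)))))))

count : {D : ℕ} {P : Pred (Fin D) lzero} → Decidable P → ℕ
count {D} P? = length (filter P? (allFin D))

count-≤-injection : {D : ℕ} {P Q : Pred (Fin D) lzero} (P? : Decidable P) (Q? : Decidable Q) →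
  (h : Fin D → Fin D) → (∀ {x} → P x → Q (h x)) → (∀ {x y} → P x → P y → h x ≡ h y → x ≡ y) →
  count P? ≤ count Q?
count-≤-injection {D} {P} P? Q? h P⇒Q h-inj =
  length-≤-injection _ (Uniqueₚ.filter⁺ P? (Uniqueₚ.allFin⁺ D)) h
    (λ x∈ → ∈-filter⁺ Q? (∈-allFin _) (P⇒Q (satisfies x∈)))
    (λ x∈ y∈ → h-inj (satisfies x∈) (satisfies y∈))
  where
  satisfies : ∀ {x} → x ∈ filter P? (allFin D) → P x
  satisfies x∈ = proj₂ (∈-filter⁻ P? {xs = allFin D} x∈)

T-==⇔≡ : {D : ℕ} {x y : Fin D} → T (x == y) ⇔ x ≡ y
T-==⇔≡ {x = x} {y} with x Finₚ.≟ y
... | yes x≡y = mk⇔ (λ _ → x≡y) _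
... | no  x≢y = mk⇔ (λ ()) x≢y

module PermutationOrbits {D : ℕ} {f : Fin D → Fin D} (f-perm : IsPerm f) where

  iter-return : ∀ a k x → iter f a x ≡ iter f (a + k) x → iter f k x ≡ x
  iter-return a k x e = iter-injective f-perm a (trans (sym (iter-+ f a k x)) (sym e))

  period : ∀ x → ∃ λ p → iter f (suc p) x ≡ x × suc p ≤ D
  period x with Finₚ.pigeonhole (n<1+n D) (λ j → iter f (toℕ j) x)
  ... | i , j , i<j , e with m≤n⇒∃[o]m+o≡n i<j
  ...   | o , 1+i+o≡j = o , iter-return (toℕ i) (suc o) x (trans e (cong (λ z → iter f z x) (sym i+1+o≡j)))
                          , ≤-trans (m≤n+m (suc o) (toℕ i)) (≤-trans (≤-reflexive i+1+o≡j) (≤-pred (Finₚ.toℕ<n j)))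
    where
    i+1+o≡j : toℕ i + suc o ≡ toℕ j
    i+1+o≡j = sym (trans (sym 1+i+o≡j) (sym (+-suc (toℕ i) o)))

  Orb-sym : ∀ {a b} → Orb f a b → Orb f b a
  Orb-sym {a} (j , refl) with period a
  ... | p , e , _ = p * j , (begin
    iter f (p * j) (iter f j a)  ≡⟨ sym (iter-+ f (p * j) j a) ⟩
    iter f (p * j + j) a         ≡⟨ cong (λ z → iter f z a) (trans (+-comm (p * j) j) (*-comm (suc p) j)) ⟩
    iter f (j * suc p) a         ≡⟨ iter-periodic f e j ⟩
    a                            ∎)
    where open ≡-Reasoning

  Orb-bounded : ∀ {a b} → Orb f a b → ∃ λ j → j < D × iter f j a ≡ b
  Orb-bounded {a} (j , refl) with period a
  ... | p , e , p<D = j % suc p , ≤-trans (m%n<n j (suc p)) p<D , iter-mod f e j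

  Orb? : ∀ x y → Dec (Orb f x y)
  Orb? x y with anyUpTo? (λ j → iter f j x Finₚ.≟ y) D
  ... | yes (j , _ , e) = yes (j , e)
  ... | no ¬bounded     = no (¬bounded ∘ Orb-bounded)

  ∈orbitList⇔Orb : ∀ {d e} → e ∈ orbitList f d ⇔ Orb f d e
  ∈orbitList⇔Orb {d} = mk⇔ from-∈ to-∈
    where
    from-∈ : ∀ {e} → e ∈ orbitList f d → Orb f d e
    from-∈ e∈ with ∈-map⁻ (λ j → iter f j d) e∈
    ... | j , _ , refl = j , refl
    to-∈ : ∀ {e} → Orb f d e → e ∈ orbitList f d
    to-∈ o with Orb-bounded o
    ... | j , j<D , refl = ∈-map⁺ (λ j → iter f j d) (∈-upTo⁺ j<D)

  inOrbit⇔Orb : ∀ {d e} → inOrbit f d e ≡ true ⇔ Orb f d e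
  inOrbit⇔Orb {d} {e} = mk⇔
    (λ h → Equivalence.to ∈orbitList⇔Orb
      (Any.map (sym ∘ Equivalence.to T-==⇔≡) (any⁻ (_== e) (orbitList f d) (Equivalence.from T-≡ h))))
    (λ o → Equivalence.to T-≡ (any⁺ (_== e)
      (Any.map (Equivalence.from T-==⇔≡ ∘ sym) (Equivalence.from ∈orbitList⇔Orb o))))

  IsMin : Fin D → Set
  IsMin d = ∀ e → Orb f d e → toℕ d ≤ toℕ e

  isMinᵇ⇔IsMin : ∀ {d} → all (d ≤ᵇᶠ_) (orbitList f d) ≡ true ⇔ IsMin d
  isMinᵇ⇔IsMin {d} = mk⇔
    (λ h e o → ≤ᵇ⇒≤ (toℕ d) (toℕ e)
      (All.lookup (all⁺ (d ≤ᵇᶠ_) (orbitList f d) (Equivalence.from T-≡ h)) (Equivalence.from ∈orbitList⇔Orb o)))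
    (λ m → Equivalence.to T-≡ (all⁻ (d ≤ᵇᶠ_)
      (All.tabulate (λ e∈ → ≤⇒≤ᵇ (m _ (Equivalence.to ∈orbitList⇔Orb e∈))))))

  IsMin-unique : ∀ {d d'} → IsMin d → IsMin d' → Orb f d d' → d ≡ d'
  IsMin-unique {d} {d'} m m' o = Finₚ.toℕ-injective (≤-antisym (m d' o) (m' d (Orb-sym o)))

  orbitMin : Fin D → Fin D
  orbitMin x = argmin toℕ x (orbitList f x)

  Orb-orbitMin : ∀ x → Orb f x (orbitMin x)
  Orb-orbitMin x with argmin-sel toℕ x (orbitList f x)
  ... | inj₁ min≡x = 0 , sym min≡x
  ... | inj₂ min∈  = Equivalence.to ∈orbitList⇔Orb min∈

  IsMin-orbitMin : ∀ x → IsMin (orbitMin x)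
  IsMin-orbitMin x e o =
    All.lookup (f[argmin]≤f[xs] x (orbitList f x)) (Equivalence.from ∈orbitList⇔Orb (Orb-trans (Orb-orbitMin x) o))

  firstReturn : ∀ d → ∃ (Least (λ n → iter f (suc n) d Finₚ.≟ d))
  firstReturn d with period d
  ... | p , e , _ = least (λ n → iter f (suc n) d Finₚ.≟ d) p e

  module _ (d : Fin D) where
    private
      q = proj₁ (firstReturn d)
      p = suc q

      returns : iter f p d ≡ d
      returns = proj₁ (proj₂ (firstReturn d))

      no-early-return : ∀ {i j} → i < j → j < p → iter f i d ≡ iter f j d → ⊥
      no-early-return {i} i<j j<p e with m≤n⇒∃[o]m+o≡n i<j
      ... | o , refl = proj₂ (proj₂ (firstReturn d)) o (≤-<-trans (m≤n+m o i) (≤-pred j<p))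
                         (iter-return i (suc o) d (trans e (cong (λ z → iter f z d) (sym (+-suc i o)))))

      iter-injective-below : ∀ {i j} → i < p → j < p → iter f i d ≡ iter f j d → i ≡ j
      iter-injective-below {i} {j} i<p j<p e with <-cmp i j
      ... | tri< i<j _ _ = ⊥-elim (no-early-return i<j j<p e)
      ... | tri≈ _ i≡j _ = i≡j
      ... | tri> _ _ j<i = ⊥-elim (no-early-return j<i i<p (sym e))

      orbit : List (Fin D)
      orbit = filter (λ e → inOrbit f d e Bool.≟ true) (allFin D)

      in-orbit : ∀ {e} → e ∈ orbit → Orb f d e
      in-orbit e∈ = Equivalence.to inOrbit⇔Orb (proj₂ (∈-filter⁻ (λ e → inOrbit f d e Bool.≟ true) {xs = allFin D} e∈))

      orbitSize≡firstReturn : orbitSize f d ≡ p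
      orbitSize≡firstReturn = ≤-antisym
        (subst (orbitSize f d ≤_) (trans (length-map _ (upTo p)) (length-upTo p))
          (length-≤-injection (map (λ j → iter f j d) (upTo p)) (Uniqueₚ.filter⁺ _ (Uniqueₚ.allFin⁺ D)) id
            (λ e∈ → let j , e = in-orbit e∈ in
              subst (_∈ map (λ j → iter f j d) (upTo p)) (trans (iter-mod f returns j) e)
                (∈-map⁺ (λ j → iter f j d) (∈-upTo⁺ (m%n<n j p))))
            (λ _ _ e → e)))
        (subst (_≤ orbitSize f d) (length-upTo p)
          (length-≤-injection orbit (Uniqueₚ.upTo⁺ p) (λ j → iter f j d)
            (λ {j} _ → ∈-filter⁺ _ (∈-allFin _) (Equivalence.from inOrbit⇔Orb (j , refl)))
            (λ i∈ j∈ → iter-injective-below (∈-upTo⁻ i∈) (∈-upTo⁻ j∈))))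

    iter-orbitSize : iter f (orbitSize f d) d ≡ d
    iter-orbitSize = trans (cong (λ z → iter f z d) orbitSize≡firstReturn) returns

orbitSize-cong : {D : ℕ} {f g : Fin D → Fin D} → (∀ x → f x ≡ g x) → ∀ d → orbitSize f d ≡ orbitSize g d
orbitSize-cong {D} {f} {g} f≗g d =
  cong length (filter-≐ _ _ (subst (_≡ true) (same _) , subst (_≡ true) (sym (same _))) (allFin D))
  where
  same : ∀ e → inOrbit f d e ≡ inOrbit g d e
  same e = cong (any (_== e)) (map-cong (λ j → iter-cong f≗g j d) (upTo D))

record OrbitCorrespondence {D : ℕ} (f g : Fin D → Fin D) : Set where
  field
    to       : Fin D → Fin D
    from     : Fin D → Fin D
    to-Orb   : ∀ {d e} → Orb f d e → Orb g (to d) (to e)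
    from-Orb : ∀ {d e} → Orb g d e → Orb f (from d) (from e)
    from-to  : ∀ d → Orb f (from (to d)) d
    to-from  : ∀ d → Orb g (to (from d)) d

OrbitCorrespondence-sym : {D : ℕ} {f g : Fin D → Fin D} → OrbitCorrespondence f g → OrbitCorrespondence g f
OrbitCorrespondence-sym c = record
  { to = from ; from = to ; to-Orb = from-Orb ; from-Orb = to-Orb ; from-to = to-from ; to-from = from-to }
  where open OrbitCorrespondence c

-- numOrbits counts orbit minima: send the minimum of an f-orbit to the minimum of the g-orbit of its image.
numOrbits-≤ : {D : ℕ} {f g : Fin D → Fin D} → IsPerm f → IsPerm g → OrbitCorrespondence f g →
  numOrbits f ≤ numOrbits g
numOrbits-≤ {f = f} {g} f-perm g-perm c =
  count-≤-injection _ _ (G.orbitMin ∘ to)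
    (λ {x} _ → Equivalence.from G.isMinᵇ⇔IsMin (G.IsMin-orbitMin (to x)))
    (λ {x} {y} x-min y-min e → F.IsMin-unique (Equivalence.to F.isMinᵇ⇔IsMin x-min)
      (Equivalence.to F.isMinᵇ⇔IsMin y-min) (Orb-trans (F.Orb-sym (from-to x))
        (Orb-trans (from-Orb (Orb-trans (G.Orb-orbitMin (to x))
          (subst (λ z → Orb g z (to y)) (sym e) (G.Orb-sym (G.Orb-orbitMin (to y))))))
          (from-to y))))
  where
  open OrbitCorrespondence c
  module F = PermutationOrbits f-perm
  module G = PermutationOrbits g-perm

numOrbits-≡ : {D : ℕ} {f g : Fin D → Fin D} → IsPerm f → IsPerm g → OrbitCorrespondence f g →
  numOrbits f ≡ numOrbits g
numOrbits-≡ f-perm g-perm c =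
  ≤-antisym (numOrbits-≤ f-perm g-perm c) (numOrbits-≤ g-perm f-perm (OrbitCorrespondence-sym c))

module Conjugate {D : ℕ} {f g : Fin D → Fin D} (f-perm : IsPerm f) (g-perm : IsPerm g)
  {h : Fin D → Fin D} (h-perm : IsPerm h) (h∘f≡g∘h : ∀ x → h (f x) ≡ g (h x)) where

  private
    module F = PermutationOrbits f-perm
    module G = PermutationOrbits g-perm
    h⁻¹ = proj₁ h-perm
    h⁻¹∘h : ∀ x → h⁻¹ (h x) ≡ x
    h⁻¹∘h = proj₁ (proj₂ h-perm)
    h∘h⁻¹ : ∀ x → h (h⁻¹ x) ≡ x
    h∘h⁻¹ = proj₂ (proj₂ h-perm)

  Orb-conj⁻¹ : ∀ {d e} → Orb g (h d) (h e) → Orb f d e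
  Orb-conj⁻¹ {d} {e} (j , q) =
    j , trans (sym (h⁻¹∘h _)) (trans (cong h⁻¹ (trans (iter-conj h h∘f≡g∘h j d) q)) (h⁻¹∘h e))

  Orb-conj⇔ : ∀ {d e} → Orb f d e ⇔ Orb g (h d) (h e)
  Orb-conj⇔ = mk⇔ (Orb-conj h h∘f≡g∘h) Orb-conj⁻¹

  orbitSize-conj : ∀ d → orbitSize g (h d) ≡ orbitSize f d
  orbitSize-conj d = ≤-antisym
    (count-≤-injection _ _ h⁻¹
      (λ {x} x∈ → Equivalence.from F.inOrbit⇔Orb (Orb-conj⁻¹
        (subst (Orb g (h d)) (sym (h∘h⁻¹ x)) (Equivalence.to G.inOrbit⇔Orb x∈))))
      (λ {x} {y} _ _ e → trans (sym (h∘h⁻¹ x)) (trans (cong h e) (h∘h⁻¹ y))))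
    (count-≤-injection _ _ h
      (λ x∈ → Equivalence.from G.inOrbit⇔Orb (Orb-conj h h∘f≡g∘h (Equivalence.to F.inOrbit⇔Orb x∈)))
      (λ _ _ → IsPerm⇒injective h-perm))

  numOrbits-conj : numOrbits f ≡ numOrbits g
  numOrbits-conj = numOrbits-≡ f-perm g-perm record
    { to = h
    ; from = h⁻¹
    ; to-Orb = Orb-conj h h∘f≡g∘h
    ; from-Orb = λ {x} {y} o → Orb-conj⁻¹ (subst₂ (Orb g) (sym (h∘h⁻¹ x)) (sym (h∘h⁻¹ y)) o)
    ; from-to = λ d → subst (Orb f (h⁻¹ (h d))) (h⁻¹∘h d) Orb-refl
    ; to-from = λ x → subst (Orb g (h (h⁻¹ x))) (h∘h⁻¹ x) Orb-refl
    }

-- Cyclic shifts along the loop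

neg-involutive : ∀ s → neg (neg s) ≡ s
neg-involutive plus  = refl
neg-involutive minus = refl

offset : ℕ → Sign → ℕ
offset n plus  = 1
offset n minus = n

toℕ-shift : ∀ {n} s (i : Fin (suc n)) → toℕ (shift s i) ≡ (toℕ i + offset n s) % suc n
toℕ-shift plus  i = Finₚ.toℕ-fromℕ< _
toℕ-shift minus i = Finₚ.toℕ-fromℕ< _

toℕ-shift-shift : ∀ {n} s t (i : Fin (suc n)) → toℕ (shift s (shift t i)) ≡ (toℕ i + (offset n t + offset n s)) % suc n
toℕ-shift-shift {n} s t i = begin
  toℕ (shift s (shift t i))                                         ≡⟨ toℕ-shift s (shift t i) ⟩
  (toℕ (shift t i) + b) % suc n                                     ≡⟨ cong (λ z → (z + b) % suc n) (toℕ-shift t i) ⟩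
  ((toℕ i + a) % suc n + b) % suc n                                 ≡⟨ %-distribˡ-+ ((toℕ i + a) % suc n) b (suc n) ⟩
  ((toℕ i + a) % suc n % suc n + b % suc n) % suc n
    ≡⟨ cong (λ z → (z + b % suc n) % suc n) (m%n%n≡m%n (toℕ i + a) (suc n)) ⟩
  ((toℕ i + a) % suc n + b % suc n) % suc n                         ≡⟨ sym (%-distribˡ-+ (toℕ i + a) b (suc n)) ⟩
  (toℕ i + a + b) % suc n                                           ≡⟨ cong (_% suc n) (+-assoc (toℕ i) a b) ⟩
  (toℕ i + (a + b)) % suc n                                         ∎
  where
  open ≡-Reasoning
  a = offset n t
  b = offset n s

shift-comm : ∀ {n} s t (i : Fin (suc n)) → shift s (shift t i) ≡ shift t (shift s i)
shift-comm {n} s t i = Finₚ.toℕ-injective (begin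
  toℕ (shift s (shift t i))                          ≡⟨ toℕ-shift-shift s t i ⟩
  (toℕ i + (offset n t + offset n s)) % suc n        ≡⟨ cong (λ z → (toℕ i + z) % suc n) (+-comm (offset n t) (offset n s)) ⟩
  (toℕ i + (offset n s + offset n t)) % suc n        ≡⟨ sym (toℕ-shift-shift t s i) ⟩
  toℕ (shift t (shift s i))                          ∎)
  where open ≡-Reasoning

shift-neg-shift : ∀ {n} s (i : Fin (suc n)) → shift s (shift (neg s) i) ≡ i
shift-neg-shift {n} s i = Finₚ.toℕ-injective (begin
  toℕ (shift s (shift (neg s) i))                    ≡⟨ toℕ-shift-shift s (neg s) i ⟩
  (toℕ i + (offset n (neg s) + offset n s)) % suc n  ≡⟨ cong (λ z → (toℕ i + z) % suc n) (full-turn s) ⟩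
  (toℕ i + suc n) % suc n                            ≡⟨ [m+n]%n≡m%n (toℕ i) (suc n) ⟩
  toℕ i % suc n                                      ≡⟨ m<n⇒m%n≡m (Finₚ.toℕ<n i) ⟩
  toℕ i                                              ∎)
  where
  open ≡-Reasoning
  full-turn : ∀ s → offset n (neg s) + offset n s ≡ suc n
  full-turn plus  = +-comm n 1
  full-turn minus = refl

shift-shift-neg : ∀ {n} s (i : Fin (suc n)) → shift (neg s) (shift s i) ≡ i
shift-shift-neg s i = subst (λ t → shift (neg s) (shift t i) ≡ i) (neg-involutive s) (shift-neg-shift (neg s) i)

shift-injective : ∀ {n} s → Injective _≡_ _≡_ (shift {n} s)
shift-injective s {i} {j} e =
  trans (sym (shift-shift-neg s i)) (trans (cong (shift (neg s)) e) (shift-shift-neg s j))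

findIn-just : {D k : ℕ} (f : Fin k → Fin D) {d : Fin D} {i : Fin k} → findIn f d ≡ just i → f i ≡ d
findIn-just {k = suc k} f {d} e with f Fin.zero Finₚ.≟ d
findIn-just {k = suc k} f {d} refl | yes f0≡d = f0≡d
findIn-just {k = suc k} f {d} e    | no _ with findIn (f ∘ Fin.suc) d in e'
findIn-just {k = suc k} f {d} refl | no _ | just _ = findIn-just (f ∘ Fin.suc) e'

findIn-nothing : {D k : ℕ} (f : Fin k → Fin D) {d : Fin D} → findIn f d ≡ nothing → ∀ i → f i ≢ d
findIn-nothing {k = suc k} f {d} e i fi≡d with f Fin.zero Finₚ.≟ d
findIn-nothing {k = suc k} f {d} () i fi≡d | yes _
findIn-nothing {k = suc k} f {d} e i fi≡d | no f0≢d with findIn (f ∘ Fin.suc) d in e'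
findIn-nothing {k = suc k} f {d} e Fin.zero    fi≡d | no f0≢d | nothing = f0≢d fi≡d
findIn-nothing {k = suc k} f {d} e (Fin.suc i) fi≡d | no f0≢d | nothing = findIn-nothing (f ∘ Fin.suc) e' i fi≡d

data FindView {D k : ℕ} (f : Fin k → Fin D) (d : Fin D) : Set where
  found    : ∀ i → f i ≡ d → findIn f d ≡ just i → FindView f d
  notFound : (∀ i → f i ≢ d) → findIn f d ≡ nothing → FindView f d

findView : {D k : ℕ} (f : Fin k → Fin D) (d : Fin D) → FindView f d
findView f d with findIn f d in e
... | just i  = found i (findIn-just f e) e
... | nothing = notFound (findIn-nothing f e) e

findIn-image : {D k : ℕ} (f : Fin k → Fin D) → Injective _≡_ _≡_ f → ∀ i → findIn f (f i) ≡ just i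
findIn-image f f-inj i with findView f (f i)
... | found j fj≡fi e = trans e (cong just (f-inj fj≡fi))
... | notFound f≢fi _ = ⊥-elim (f≢fi i refl)

cycleAlong : {D k : ℕ} → (Fin (suc k) → Fin D) → Sign → Fin D → Fin D
cycleAlong f s d with findIn f d
... | just i  = f (shift s i)
... | nothing = d

module _ {D k : ℕ} (f : Fin (suc k) → Fin D) (f-inj : Injective _≡_ _≡_ f) where

  cycleAlong-image : ∀ s i → cycleAlong f s (f i) ≡ f (shift s i)
  cycleAlong-image s i rewrite findIn-image f f-inj i = refl

  cycleAlong-outside : ∀ s {d} → (∀ i → f i ≢ d) → cycleAlong f s d ≡ d
  cycleAlong-outside s {d} f≢d with findView f d
  ... | found i fi≡d _ = ⊥-elim (f≢d i fi≡d)
  ... | notFound _ e rewrite e = refl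

  cycleAlong-neg : ∀ s d → cycleAlong f (neg s) (cycleAlong f s d) ≡ d
  cycleAlong-neg s d with findView f d
  ... | found i refl e rewrite e = trans (cycleAlong-image (neg s) (shift s i)) (cong f (shift-shift-neg s i))
  ... | notFound f≢d e rewrite e = cycleAlong-outside (neg s) f≢d

  cycleAlong-neg′ : ∀ s d → cycleAlong f s (cycleAlong f (neg s) d) ≡ d
  cycleAlong-neg′ s d = subst (λ t → cycleAlong f t (cycleAlong f (neg s) d) ≡ d) (neg-involutive s) (cycleAlong-neg (neg s) d)

  cycleAlong-perm : ∀ s → IsPerm (cycleAlong f s)
  cycleAlong-perm s = cycleAlong f (neg s) , cycleAlong-neg s , cycleAlong-neg′ s

-- Walks and their homotopies

Reach-trans : {D : ℕ} {m : RawMap D} {a b c : Fin D} → Reach m a b → Reach m b c → Reach m a c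
Reach-trans here     r' = r'
Reach-trans (viaσ r) r' = viaσ (Reach-trans r r')
Reach-trans (viaα r) r' = viaα (Reach-trans r r')

Reach-iter : {D : ℕ} (m : RawMap D) (t : ℕ) (d : Fin D) → Reach m d (iter (σ m) t d)
Reach-iter m zero    d = here
Reach-iter m (suc t) d = viaσ (subst (Reach m (σ m d)) (iter-commute (σ m) t d) (Reach-iter m t (σ m d)))

Orb⇒Reach : {D : ℕ} (m : RawMap D) {d e : Fin D} → Orb (σ m) d e → Reach m d e
Orb⇒Reach m {d} (t , refl) = Reach-iter m t d

module Walks {D : ℕ} (m : RawMap D) (σ-perm : IsPerm (σ m)) (α-invol : ∀ d → α m (α m d) ≡ d) where

  open PermutationOrbits σ-perm using (Orb-sym)

  φ-perm : IsPerm (φ m)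
  φ-perm = IsPerm-∘ (α m , α-invol , α-invol) σ-perm

  Walk : Fin D → List (Fin D) → Fin D → Set
  Walk s []       t = Orb (σ m) s t
  Walk s (x ∷ xs) t = Orb (σ m) s x × Walk (α m x) xs t

  Walk-≡ : ∀ {s u v t} → u ≡ v → Walk s u t → Walk s v t
  Walk-≡ refl w = w

  Walk-startOrb : ∀ {s s' w t} → Orb (σ m) s s' → Walk s' w t → Walk s w t
  Walk-startOrb {w = []}    o w        = Orb-trans o w
  Walk-startOrb {w = x ∷ _} o (o' , w) = Orb-trans o o' , w

  Walk-endOrb : ∀ {s w t t'} → Walk s w t → Orb (σ m) t t' → Walk s w t'
  Walk-endOrb {w = []}    w        o = Orb-trans w o
  Walk-endOrb {w = x ∷ _} (o' , w) o = o' , Walk-endOrb w o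

  Walk-++ : ∀ {s u t v r} → Walk s u t → Walk t v r → Walk s (u ++ v) r
  Walk-++ {u = []}    w        w' = Walk-startOrb w w'
  Walk-++ {u = x ∷ _} (o , w) w' = o , Walk-++ w w'

  Walk-split : ∀ {s} u {v r} → Walk s (u ++ v) r → ∃ λ t → Walk s u t × Walk t v r
  Walk-split {s} []      w       = s , Orb-refl , w
  Walk-split     (x ∷ u) (o , w) with Walk-split u w
  ... | t , w₁ , w₂ = t , (o , w₁) , w₂

  Walk⇒Chain : ∀ {s x xs t} → Walk s (x ∷ xs) t → Chain m (x ∷ xs) × Orb (σ m) (α m (lastOf x xs)) t
  Walk⇒Chain {xs = []}    (o , w) = tt , w
  Walk⇒Chain {xs = y ∷ _} (o , w) with Walk⇒Chain w
  ... | c , e = (proj₁ w , c) , e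

  Chain⇒Walk : ∀ {s x xs t} → Chain m (x ∷ xs) → Orb (σ m) s x → Orb (σ m) (α m (lastOf x xs)) t → Walk s (x ∷ xs) t
  Chain⇒Walk {xs = []}    c        o e = o , e
  Chain⇒Walk {xs = y ∷ _} (o' , c) o e = o , Chain⇒Walk c o' e

  Walk⇒ClosedPath : ∀ {s w} → Walk s w s → ClosedPath m w
  Walk⇒ClosedPath {w = []}    _ = tt
  Walk⇒ClosedPath {w = x ∷ _} w with Walk⇒Chain w
  ... | c , e = c , Orb-trans e (proj₁ w)

  ClosedPath⇒Walk : ∀ {x xs} → ClosedPath m (x ∷ xs) → Walk x (x ∷ xs) x
  ClosedPath⇒Walk (c , e) = Chain⇒Walk c Orb-refl e

  data PathHomotopic (s t : Fin D) : List (Fin D) → List (Fin D) → Set where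
    ph-delete : ∀ p X q → Elementary m X → Walk s (p ++ X ++ q) t → PathHomotopic s t (p ++ X ++ q) (p ++ q)
    ph-refl   : ∀ {u} → PathHomotopic s t u u
    ph-sym    : ∀ {u v} → PathHomotopic s t u v → PathHomotopic s t v u
    ph-trans  : ∀ {u v w} → PathHomotopic s t u v → PathHomotopic s t v w → PathHomotopic s t u w

  ph-≡ : ∀ {s t u v} → u ≡ v → PathHomotopic s t u v
  ph-≡ refl = ph-refl

  ph-wrap : ∀ {s t u v a b p q} → PathHomotopic s t u v → Walk a p s → Walk t q b →
    PathHomotopic a b (p ++ u ++ q) (p ++ v ++ q)
  ph-wrap {p = p'} {q'} (ph-delete p X q e w) wp wq =
    subst₂ (PathHomotopic _ _) (sym reassoc-X) (sym reassoc)
      (ph-delete (p' ++ p) X (q ++ q') e (Walk-≡ reassoc-X (Walk-++ wp (Walk-++ w wq))))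
    where
    open ≡-Reasoning
    reassoc-X : p' ++ (p ++ X ++ q) ++ q' ≡ (p' ++ p) ++ X ++ (q ++ q')
    reassoc-X = begin
      p' ++ (p ++ X ++ q) ++ q'    ≡⟨ cong (p' ++_) (++-assoc p (X ++ q) q') ⟩
      p' ++ p ++ (X ++ q) ++ q'    ≡⟨ cong (λ z → p' ++ p ++ z) (++-assoc X q q') ⟩
      p' ++ p ++ X ++ q ++ q'      ≡⟨ sym (++-assoc p' p (X ++ q ++ q')) ⟩
      (p' ++ p) ++ X ++ (q ++ q')  ∎
    reassoc : p' ++ (p ++ q) ++ q' ≡ (p' ++ p) ++ (q ++ q')
    reassoc = trans (cong (p' ++_) (++-assoc p q q')) (sym (++-assoc p' p (q ++ q')))
  ph-wrap ph-refl          wp wq = ph-refl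
  ph-wrap (ph-sym h)       wp wq = ph-sym (ph-wrap h wp wq)
  ph-wrap (ph-trans h h')  wp wq = ph-trans (ph-wrap h wp wq) (ph-wrap h' wp wq)

  ph-++ʳ : ∀ {s t b u v q} → PathHomotopic s t u v → Walk t q b → PathHomotopic s b (u ++ q) (v ++ q)
  ph-++ʳ h wq = ph-wrap {p = []} h Orb-refl wq

  ph-++ˡ : ∀ {a s t u v p} → Walk a p s → PathHomotopic s t u v → PathHomotopic a t (p ++ u) (p ++ v)
  ph-++ˡ {a} {s} {t} {u} {v} {p} wp h =
    subst₂ (λ x y → PathHomotopic a t (p ++ x) (p ++ y)) (++-identityʳ u) (++-identityʳ v) (ph-wrap {q = []} h wp Orb-refl)

  PathHomotopic-setoid : Fin D → Fin D → Setoid lzero lzero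
  PathHomotopic-setoid s t = record
    { Carrier = List (Fin D)
    ; _≈_ = PathHomotopic s t
    ; isEquivalence = record { refl = ph-refl ; sym = ph-sym ; trans = ph-trans }
    }

  ph-moveEnds : ∀ {s t s' t' u v} → PathHomotopic s t u v → Orb (σ m) s' s → Orb (σ m) t t' → PathHomotopic s' t' u v
  ph-moveEnds (ph-delete p X q e w) o o' = ph-delete p X q e (Walk-startOrb o (Walk-endOrb w o'))
  ph-moveEnds ph-refl               o o' = ph-refl
  ph-moveEnds (ph-sym h)            o o' = ph-sym (ph-moveEnds h o o')
  ph-moveEnds (ph-trans h h')       o o' = ph-trans (ph-moveEnds h o o') (ph-moveEnds h' o o')

  PathHomotopic⇒Homotopic : ∀ {s u v} → PathHomotopic s s u v → Homotopic m u v
  PathHomotopic⇒Homotopic (ph-delete p X q e w) = h-step (delete p X q e (Walk⇒ClosedPath w))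
  PathHomotopic⇒Homotopic ph-refl               = h-refl
  PathHomotopic⇒Homotopic (ph-sym h)            = h-sym (PathHomotopic⇒Homotopic h)
  PathHomotopic⇒Homotopic (ph-trans h h')       = h-trans (PathHomotopic⇒Homotopic h) (PathHomotopic⇒Homotopic h')

  ph-backtrack : ∀ {s t} p e q → Walk s (p ++ e ∷ α m e ∷ q) t → PathHomotopic s t (p ++ e ∷ α m e ∷ q) (p ++ q)
  ph-backtrack p e q w = ph-delete p (e ∷ α m e ∷ []) q (backtrack e) w

  ph-backtrack′ : ∀ {s t} p e q → Walk s (p ++ α m e ∷ e ∷ q) t → PathHomotopic s t (p ++ α m e ∷ e ∷ q) (p ++ q)
  ph-backtrack′ {s} {t} p e q w =
    subst (λ z → PathHomotopic s t (p ++ α m e ∷ z ∷ q) (p ++ q)) (α-invol e)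
      (ph-backtrack p (α m e) q (subst (λ z → Walk s (p ++ α m e ∷ z ∷ q) t) (sym (α-invol e)) w))

  faceWalkUpTo : Fin D → ℕ → List (Fin D)
  faceWalkUpTo x k = map (λ j → σ m (iter (φ m) j x)) (upTo k)

  faceWalkUpTo-suc : ∀ x k → faceWalkUpTo x (suc k) ≡ faceWalkUpTo x k ++ σ m (iter (φ m) k x) ∷ []
  faceWalkUpTo-suc x k = trans (cong (map (λ j → σ m (iter (φ m) j x))) (sym (applyUpTo-∷ʳ id k)))
                               (map-++ (λ j → σ m (iter (φ m) j x)) (upTo k) (k ∷ []))

  Walk-faceWalkUpTo : ∀ x k → Walk x (faceWalkUpTo x k) (iter (φ m) k x)
  Walk-faceWalkUpTo x zero    = Orb-refl
  Walk-faceWalkUpTo x (suc k) = subst (λ z → Walk x z (iter (φ m) (suc k) x)) (sym (faceWalkUpTo-suc x k))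
                                      (Walk-++ (Walk-faceWalkUpTo x k) ((1 , refl) , Orb-refl))

  Walk-faceWalk : ∀ x → Walk x (faceWalk m x) x
  Walk-faceWalk x = subst (Walk x (faceWalk m x)) (PermutationOrbits.iter-orbitSize φ-perm x)
                          (Walk-faceWalkUpTo x (faceDeg m x))

  Walk-sameDarts : ∀ {a b c e} X → Walk a X b → Walk c X e → X ≡ [] ⊎ (Orb (σ m) a c × Orb (σ m) e b)
  Walk-sameDarts []       _ _  = inj₁ refl
  Walk-sameDarts (x ∷ xs) w w' with Walk⇒Chain w | Walk⇒Chain w'
  ... | _ , e | _ , e' = inj₂ (Orb-trans (proj₁ w) (Orb-sym (proj₁ w')) , Orb-trans (Orb-sym e') e)

  Walk-sameDarts-closed : ∀ {X a b c} → Walk a X b → Walk c X c → Orb (σ m) a b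
  Walk-sameDarts-closed {[]}     w _ = w
  Walk-sameDarts-closed {x ∷ xs} w w' with Walk-sameDarts (x ∷ xs) w w'
  ... | inj₂ (a∼c , c∼b) = Orb-trans a∼c c∼b

  Elementary-closed : ∀ {X a b} → Elementary m X → Walk a X b → Orb (σ m) a b
  Elementary-closed (backtrack e) (o₁ , o₂ , o₃) = Orb-trans o₁ (subst (λ z → Orb (σ m) z _) (α-invol e) o₃)
  Elementary-closed (face d)      w              = Walk-sameDarts-closed w (Walk-faceWalk d)

  Walk-delete : ∀ {s t} p {X} q → Elementary m X → Walk s (p ++ X ++ q) t → Walk s (p ++ q) t
  Walk-delete p {X} q e w with Walk-split p w
  ... | _ , w₁ , w₂ with Walk-split X w₂
  ... | _ , w₃ , w₄ = Walk-++ w₁ (Walk-startOrb (Elementary-closed e w₃) w₄)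

  Cancelling : List (Fin D) → Set
  Cancelling X = X ≡ [] ⊎ ∃ λ x → X ≡ x ∷ α m x ∷ []

  ph-cancel : ∀ {s t} p {X} q → Cancelling X → Walk s (p ++ X ++ q) t →
    PathHomotopic s t (p ++ X ++ q) (p ++ q) × Walk s (p ++ q) t
  ph-cancel p q (inj₁ refl)       w = ph-refl , w
  ph-cancel p q (inj₂ (x , refl)) w = ph-backtrack p x q w , Walk-delete p q (backtrack x) w

  -- Prepend the reverse of p and cancel it against p one backtrack at a time.
  ph-cancelˡ : ∀ {a s t} p {u v} → Walk a p s → Walk s u t → Walk s v t →
    PathHomotopic a t (p ++ u) (p ++ v) → PathHomotopic s t u v
  ph-cancelˡ []      wp       _  _  h = ph-moveEnds h (Orb-sym wp) Orb-refl
  ph-cancelˡ {a} {s} {t} (k ∷ p) {u} {v} (o , wp) wu wv h = ph-cancelˡ p wp wu wv (begin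
      p ++ u                  ≈⟨ ph-backtrack′ [] k (p ++ u) back-u ⟨
      α m k ∷ k ∷ p ++ u      ≈⟨ ph-++ˡ {p = α m k ∷ []} back h ⟩
      α m k ∷ k ∷ p ++ v      ≈⟨ ph-backtrack′ [] k (p ++ v) back-v ⟩
      p ++ v                  ∎)
    where
    open Reasoning (PathHomotopic-setoid _ _)
    back : Walk (α m k) (α m k ∷ []) a
    back = Orb-refl , subst (λ z → Orb (σ m) z a) (sym (α-invol k)) (Orb-sym o)
    back-u : Walk (α m k) (α m k ∷ k ∷ p ++ u) t
    back-u = Walk-++ {u = α m k ∷ []} {v = k ∷ p ++ u} back (o , Walk-++ wp wu)
    back-v : Walk (α m k) (α m k ∷ k ∷ p ++ v) t
    back-v = Walk-++ {u = α m k ∷ []} {v = k ∷ p ++ v} back (o , Walk-++ wp wv)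

-- Cutting along γ and regluing

module Reglue {D : ℕ} (M : RawMap D) (γ : Loop D) (ε : Sign) where

  out : Fin (suc (len γ)) → Fin D
  out = darts γ

  inn : Fin (suc (len γ)) → Fin D
  inn i = α M (out (shift minus i))

  cornerMap≡cycleAlong : ∀ d → cornerMap M γ ε d ≡ cycleAlong out (neg ε) d
  cornerMap≡cycleAlong d with findIn out d
  ... | just _  = refl
  ... | nothing = refl

  Φσ≡cycleAlong : ∀ d → Φσ M γ ε d ≡ cycleAlong inn (neg ε) (σ M (cycleAlong out ε d))
  Φσ≡cycleAlong d with findIn out d in e
  ... | just i with inn Fin.zero Finₚ.≟ σ M (out (shift ε i))
  ...   | yes _ = refl
  ...   | no _ with findIn (inn ∘ Fin.suc) (σ M (out (shift ε i)))
  ...     | just _  = refl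
  ...     | nothing rewrite e = refl
  Φσ≡cycleAlong d | nothing with inn Fin.zero Finₚ.≟ σ M d
  ...   | yes _ = refl
  ...   | no _ with findIn (inn ∘ Fin.suc) (σ M d)
  ...     | just _  = refl
  ...     | nothing rewrite e = refl

module Reglued {D : ℕ} (M : RawMap D) (γ : Loop D) (ε : Sign) (isMap : IsMap M)
  (loop : IsLoop M γ) (simple : IsSimple M γ) (inn≢out : ∀ i j → Reglue.inn M γ ε i ≢ Reglue.out M γ ε j) where

  open Reglue M γ ε public
  open IsMap isMap
  open PermutationOrbits σ-perm using (Orb-sym; Orb?)

  n : ℕ
  n = len γ

  M̃ : RawMap D
  M̃ = Φmap M γ ε

  σ̃ : Fin D → Fin D
  σ̃ = Φσ M γ ε

  α-injective : Injective _≡_ _≡_ (α M)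
  α-injective {a} {b} e = trans (sym (α-invol a)) (trans (cong (α M) e) (α-invol b))

  out-injective : Injective _≡_ _≡_ out
  out-injective {i} {j} e = simple i j (0 , e)

  inn-injective : Injective _≡_ _≡_ inn
  inn-injective e = shift-injective minus (out-injective (α-injective e))

  Orb-inn-out : ∀ i → Orb (σ M) (inn i) (out i)
  Orb-inn-out i = subst (λ z → Orb (σ M) (inn i) (out z)) (shift-neg-shift plus i) (loop (shift minus i))

  Orb-out-inn : ∀ i → Orb (σ M) (out i) (inn i)
  Orb-out-inn i = Orb-sym (Orb-inn-out i)

  α-out : ∀ j → α M (out j) ≡ inn (shift plus j)
  α-out j = cong (α M ∘ out) (sym (shift-shift-neg plus j))

  α-inn : ∀ i → α M (inn i) ≡ out (shift minus i)
  α-inn i = α-invol _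

  loopVertex-unique : ∀ {i j d} → Orb (σ M) (out i) d → Orb (σ M) (out j) d → i ≡ j
  loopVertex-unique o o' = simple _ _ (Orb-trans o (Orb-sym o'))

  σ̃-out : ∀ i → σ̃ (out i) ≡ cycleAlong inn (neg ε) (σ M (out (shift ε i)))
  σ̃-out i = trans (Φσ≡cycleAlong (out i)) (cong (cycleAlong inn (neg ε) ∘ σ M) (cycleAlong-image out out-injective ε i))

  σ̃-out′ : ∀ i → σ̃ (out (shift (neg ε) i)) ≡ cycleAlong inn (neg ε) (σ M (out i))
  σ̃-out′ i = trans (σ̃-out _) (cong (λ z → cycleAlong inn (neg ε) (σ M (out z))) (shift-neg-shift ε i))

  σ̃-notOut : ∀ d → (∀ j → out j ≢ d) → σ̃ d ≡ cycleAlong inn (neg ε) (σ M d)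
  σ̃-notOut d d∉ = trans (Φσ≡cycleAlong d) (cong (cycleAlong inn (neg ε) ∘ σ M) (cycleAlong-outside out out-injective ε d∉))

  σ̃-unchanged : ∀ d → (∀ j → out j ≢ d) → (∀ j → inn j ≢ σ M d) → σ̃ d ≡ σ M d
  σ̃-unchanged d d∉ σd∉ = trans (σ̃-notOut d d∉) (cycleAlong-outside inn inn-injective (neg ε) σd∉)

  σ̃-before-inn : ∀ d j → (∀ j → out j ≢ d) → inn j ≡ σ M d → σ̃ d ≡ inn (shift (neg ε) j)
  σ̃-before-inn d j d∉ e =
    trans (σ̃-notOut d d∉) (trans (cong (cycleAlong inn (neg ε)) (sym e)) (cycleAlong-image inn inn-injective (neg ε) j))

  Φσ-involutive : ∀ d → Φσ M̃ γ (neg ε) d ≡ σ M d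
  Φσ-involutive d = begin
    Φσ M̃ γ (neg ε) d
      ≡⟨ Reglue.Φσ≡cycleAlong M̃ γ (neg ε) d ⟩
    cycleAlong inn (neg (neg ε)) (σ̃ (cycleAlong out (neg ε) d))
      ≡⟨ cong (cycleAlong inn (neg (neg ε))) (Φσ≡cycleAlong _) ⟩
    cycleAlong inn (neg (neg ε)) (cycleAlong inn (neg ε) (σ M (cycleAlong out ε (cycleAlong out (neg ε) d))))
      ≡⟨ cong (λ z → cycleAlong inn (neg (neg ε)) (cycleAlong inn (neg ε) (σ M z))) (cycleAlong-neg′ out out-injective ε d) ⟩
    cycleAlong inn (neg (neg ε)) (cycleAlong inn (neg ε) (σ M d))
      ≡⟨ cycleAlong-neg inn inn-injective (neg ε) (σ M d) ⟩
    σ M d ∎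
    where open ≡-Reasoning

  σ̃-perm : IsPerm σ̃
  σ̃-perm = IsPerm-cong (λ d → sym (Φσ≡cycleAlong d))
    (IsPerm-∘ (cycleAlong-perm inn inn-injective (neg ε)) (IsPerm-∘ σ-perm (cycleAlong-perm out out-injective ε)))

  Orb̃-sym : ∀ {a b} → Orb σ̃ a b → Orb σ̃ b a
  Orb̃-sym = PermutationOrbits.Orb-sym σ̃-perm

  -- Counterclockwise around v_i, the darts strictly between γ_i and the reverse of γ_{i-1} are the darts on
  -- the left of γ; regluing moves them to the vertex of γ_{i∓1}.
  opaque
    innTurn : ∀ i → ∃ λ a → iter (σ M) (suc a) (out i) ≡ inn i × (∀ m → m < suc a → iter (σ M) m (out i) ≢ inn i)
    innTurn i with least (λ t → iter (σ M) t (out i) Finₚ.≟ inn i) (proj₁ (Orb-out-inn i)) (proj₂ (Orb-out-inn i))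
    ... | zero  , e , _     = ⊥-elim (inn≢out i i (sym e))
    ... | suc a , e , below = a , e , below

  turn : Fin (suc n) → ℕ
  turn i = suc (proj₁ (innTurn i))

  iter-turn : ∀ i → iter (σ M) (turn i) (out i) ≡ inn i
  iter-turn i = proj₁ (proj₂ (innTurn i))

  turn-least : ∀ i m → m < turn i → iter (σ M) m (out i) ≢ inn i
  turn-least i = proj₂ (proj₂ (innTurn i))

  Left : Fin (suc n) → Fin D → Set
  Left i d = ∃ λ t → 0 < t × t < turn i × iter (σ M) t (out i) ≡ d

  Left? : ∀ i d → Dec (Left i d)
  Left? i d with anyUpTo? (λ t → (0 <? t) ×-dec (iter (σ M) t (out i) Finₚ.≟ d)) (turn i)
  ... | yes (t , t<turn , 0<t , e) = yes (t , 0<t , t<turn , e)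
  ... | no ¬left = no (λ { (t , 0<t , t<turn , e) → ¬left (t , t<turn , 0<t , e) })

  Left⇒Orb : ∀ {i d} → Left i d → Orb (σ M) (out i) d
  Left⇒Orb (t , _ , _ , e) = t , e

  Left-unique : ∀ {i j d} → Left i d → Left j d → i ≡ j
  Left-unique l l' = loopVertex-unique (Left⇒Orb l) (Left⇒Orb l')

  Left⇒notOut : ∀ {i d} → Left i d → ∀ j → out j ≢ d
  Left⇒notOut {i} {d} (t , 0<t , t<turn , e) j e' with loopVertex-unique (t , e) (0 , e')
  ... | refl = turn-least i (turn i ∸ t) (∸-monoʳ-< {turn i} {t} {0} 0<t (<⇒≤ t<turn)) (begin
    iter (σ M) (turn i ∸ t) (out i)               ≡⟨ cong (iter (σ M) (turn i ∸ t)) (trans e' (sym e)) ⟩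
    iter (σ M) (turn i ∸ t) (iter (σ M) t (out i)) ≡⟨ sym (iter-+ (σ M) (turn i ∸ t) t (out i)) ⟩
    iter (σ M) (turn i ∸ t + t) (out i)           ≡⟨ cong (λ z → iter (σ M) z (out i)) (m∸n+n≡m (<⇒≤ t<turn)) ⟩
    iter (σ M) (turn i) (out i)                   ≡⟨ iter-turn i ⟩
    inn i                                         ∎)
    where open ≡-Reasoning

  Left⇒notInn : ∀ {i d} → Left i d → ∀ j → inn j ≢ d
  Left⇒notInn {i} {d} (t , 0<t , t<turn , e) j e' with loopVertex-unique (t , e) (Orb-trans (Orb-out-inn j) (0 , e'))
  ... | refl = turn-least i t t<turn (trans e (sym e'))

  Left-σ⁻¹ : ∀ {i c} → Left i (σ M c) → Left i c ⊎ out i ≡ c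
  Left-σ⁻¹ {i} {c} (zero , () , _ , _)
  Left-σ⁻¹ {i} {c} (suc zero , _ , _ , e) = inj₂ (IsPerm⇒injective σ-perm e)
  Left-σ⁻¹ {i} {c} (suc (suc t) , _ , lt , e) = inj₁ (suc t , s≤s z≤n , <-trans (n<1+n (suc t)) lt , IsPerm⇒injective σ-perm e)

  Left-before-inn : ∀ {j c} → inn j ≡ σ M c → Left j c ⊎ out j ≡ c
  Left-before-inn {j} {c} e with proj₁ (innTurn j) | iter-turn j
  ... | zero  | σ⇒inn = inj₂ (IsPerm⇒injective σ-perm (trans σ⇒inn e))
  ... | suc a | σ⇒inn = inj₁ (suc a , s≤s z≤n , ≤-refl , IsPerm⇒injective σ-perm (trans σ⇒inn e))

  Left-σ : ∀ {i c} → Left i c → Left i (σ M c) ⊎ σ M c ≡ inn i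
  Left-σ {i} {c} (t , 0<t , t<turn , e) with m≤n⇒m<n∨m≡n t<turn
  ... | inj₁ lt = inj₁ (suc t , s≤s z≤n , lt , cong (σ M) e)
  ... | inj₂ eq = inj₂ (trans (cong (σ M) (sym e)) (trans (cong (λ z → iter (σ M) z (out i)) eq) (iter-turn i)))

  Left-σ-out : ∀ i → Left i (σ M (out i)) ⊎ σ M (out i) ≡ inn i
  Left-σ-out i with m≤n⇒m<n∨m≡n (s≤s (z≤n {proj₁ (innTurn i)}))
  ... | inj₁ lt = inj₁ (1 , s≤s z≤n , lt , refl)
  ... | inj₂ eq = inj₂ (trans (cong (λ z → iter (σ M) z (out i)) eq) (iter-turn i))

  data LeftView (d : Fin D) : Set where
    left  : ∀ i → Left i d → LeftView d
    notLeft : (∀ i → ¬ Left i d) → LeftView d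

  opaque
    leftView : ∀ d → LeftView d
    leftView d with Finₚ.any? (λ i → Left? i d)
    ... | yes (i , l) = left i l
    ... | no h = notLeft (λ i l → h (i , l))

  OffLoop : Fin D → Set
  OffLoop d = ∀ i → ¬ Orb (σ M) (out i) d

  data VertexView (d : Fin D) : Set where
    onLoop  : ∀ i → Orb (σ M) (out i) d → VertexView d
    offLoop : OffLoop d → VertexView d

  opaque
    vertexView : ∀ d → VertexView d
    vertexView d with Finₚ.any? (λ i → Orb? (out i) d)
    ... | yes (i , o) = onLoop i o
    ... | no h = offLoop (λ i o → h (i , o))

  Plain : Fin D → Set
  Plain d = (∀ j → out j ≢ d) × (∀ j → ¬ Left j d)

  Plain⇒σ-notInn : ∀ {d} → Plain d → ∀ j → inn j ≢ σ M d
  Plain⇒σ-notInn (po , pl) j e with Left-before-inn e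
  ... | inj₁ l = pl j l
  ... | inj₂ o = po j o

  Plain⇒σ̃≡σ : ∀ {d} → Plain d → σ̃ d ≡ σ M d
  Plain⇒σ̃≡σ {d} p = σ̃-unchanged d (proj₁ p) (Plain⇒σ-notInn p)

  Plain⇒σ-notLeft : ∀ {d} → Plain d → ∀ j → ¬ Left j (σ M d)
  Plain⇒σ-notLeft (po , pl) j l with Left-σ⁻¹ l
  ... | inj₁ l' = pl j l'
  ... | inj₂ o = po j o

  -- Counterclockwise from inn i to out i lie the right darts of v_i, where σ̃ agrees with σ.
  Orb̃-inn-out : ∀ i → Orb σ̃ (inn i) (out i)
  Orb̃-inn-out i with least (λ t → iter (σ M) t (inn i) Finₚ.≟ out i) (proj₁ (Orb-inn-out i)) (proj₂ (Orb-inn-out i))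
  ... | b , σᵇ≡out , before-out = b , trans (proj₁ (walk b ≤-refl)) σᵇ≡out
    where
    walk : ∀ t → t ≤ b → iter σ̃ t (inn i) ≡ iter (σ M) t (inn i) × (t < b → Plain (iter (σ M) t (inn i)))
    walk zero    _    = refl , λ _ → (λ j e → inn≢out i j (sym e)) , (λ j l → Left⇒notInn l i refl)
    walk (suc t) t<b with walk t (<⇒≤ t<b)
    ... | e , plain = trans (cong σ̃ e) (Plain⇒σ̃≡σ (plain t<b)) , λ 1+t<b → notOut 1+t<b , Plain⇒σ-notLeft (plain t<b)
      where
      notOut : suc t < b → ∀ j → out j ≢ iter (σ M) (suc t) (inn i)
      notOut 1+t<b j e = before-out (suc t) 1+t<b (trans (sym e) (cong out j≡i))
        where j≡i = loopVertex-unique (0 , e) (Orb-trans (Orb-out-inn i) (suc t , refl))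

  Placed : Fin (suc n) → Fin D → Set
  Placed i x = (Left i x × Orb σ̃ (out (shift (neg ε) i)) x) ⊎ ((∀ j → ¬ Left j x) × Orb σ̃ (out i) x)

  Orb-out-split′ : ∀ i t → Placed i (iter (σ M) t (out i))
  Orb-out-split′ i zero = inj₂ ((λ j l → Left⇒notOut l i refl) , Orb-refl)
  Orb-out-split′ i (suc t) with out i Finₚ.≟ iter (σ M) t (out i)
  ... | yes e rewrite sym e with Left-σ-out i
  ...   | inj₁ l    = inj₁ (l , 1 , trans (σ̃-out′ i) (cycleAlong-outside inn inn-injective (neg ε) (Left⇒notInn l)))
  ...   | inj₂ e′   = inj₂ ((λ j l → Left⇒notInn l i (sym e′)) , subst (Orb σ̃ (out i)) (sym e′) (Orb̃-sym (Orb̃-inn-out i)))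
  Orb-out-split′ i (suc t) | no ne with Orb-out-split′ i t
  ... | inj₁ (l , o) with Left-σ l
  ...   | inj₁ l′   = inj₁ (l′ , Orb-trans o (1 , σ̃-unchanged _ (Left⇒notOut l) (Left⇒notInn l′)))
  ...   | inj₂ e′   = inj₂ ((λ j l″ → Left⇒notInn l″ i (sym e′)) , subst (Orb σ̃ (out i)) (sym e′) (Orb̃-sym (Orb̃-inn-out i)))
  Orb-out-split′ i (suc t) | no ne | inj₂ (nl , o) = inj₂ (Plain⇒σ-notLeft p , Orb-trans o (1 , Plain⇒σ̃≡σ p))
    where
    p : Plain (iter (σ M) t (out i))
    p = (λ j e → ne (trans (cong out (loopVertex-unique (t , refl) (0 , e))) e)) , nl

  Orb-out-split : ∀ {i x} → Orb (σ M) (out i) x → Placed i x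
  Orb-out-split {i} (t , refl) = Orb-out-split′ i t

  OffLoop⇒notOut : ∀ {d} → OffLoop d → ∀ j → out j ≢ d
  OffLoop⇒notOut off j e = off j (0 , e)

  OffLoop⇒σ-notInn : ∀ {d} → OffLoop d → ∀ j → inn j ≢ σ M d
  OffLoop⇒σ-notInn off j e = off j (Orb-trans (Orb-out-inn j) (Orb-trans (0 , e) (Orb-sym (1 , refl))))

  OffLoop⇒σ̃≡σ : ∀ {d} → OffLoop d → σ̃ d ≡ σ M d
  OffLoop⇒σ̃≡σ {d} off = σ̃-unchanged d (OffLoop⇒notOut off) (OffLoop⇒σ-notInn off)

  OffLoop-σ : ∀ {d} → OffLoop d → OffLoop (σ M d)
  OffLoop-σ off i o = off i (Orb-trans o (Orb-sym (1 , refl)))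

  OffLoop-iter : ∀ {d} → OffLoop d → ∀ t → iter σ̃ t d ≡ iter (σ M) t d × OffLoop (iter (σ M) t d)
  OffLoop-iter off zero = refl , off
  OffLoop-iter off (suc t) with OffLoop-iter off t
  ... | e , off' = trans (cong σ̃ e) (OffLoop⇒σ̃≡σ off') , OffLoop-σ off'

  OffLoop-Orb→ : ∀ {d e} → OffLoop d → Orb (σ M) d e → Orb σ̃ d e
  OffLoop-Orb→ off (t , q) = t , trans (proj₁ (OffLoop-iter off t)) q

  OffLoop-Orb← : ∀ {d e} → OffLoop d → Orb σ̃ d e → Orb (σ M) d e
  OffLoop-Orb← off (t , q) = t , trans (sym (proj₁ (OffLoop-iter off t))) q

  Left⇒onLoop : ∀ {i d} → Left i d → ¬ OffLoop d
  Left⇒onLoop l off = off _ (Left⇒Orb l)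

  opaque
    loopIndex̃ : Fin D → Maybe (Fin (suc n))
    loopIndex̃ d with leftView d | vertexView d
    ... | left i _ | _ = just (shift (neg ε) i)
    ... | notLeft _ | onLoop i _ = just i
    ... | notLeft _ | offLoop _ = nothing

    loopIndex̃-Left : ∀ {i d} → Left i d → loopIndex̃ d ≡ just (shift (neg ε) i)
    loopIndex̃-Left {i} {d} l with leftView d | vertexView d
    ... | left j l' | _ = cong (λ z → just (shift (neg ε) z)) (Left-unique l' l)
    ... | notLeft h | _ = ⊥-elim (h i l)

    loopIndex̃-onLoop : ∀ {i d} → (∀ j → ¬ Left j d) → Orb (σ M) (out i) d → loopIndex̃ d ≡ just i
    loopIndex̃-onLoop {i} {d} nl o with leftView d | vertexView d
    ... | left j l | _ = ⊥-elim (nl j l)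
    ... | notLeft _ | onLoop j o' = cong just (loopVertex-unique o' o)
    ... | notLeft _ | offLoop off = ⊥-elim (off i o)

    loopIndex̃-offLoop : ∀ {d} → OffLoop d → loopIndex̃ d ≡ nothing
    loopIndex̃-offLoop {d} off with leftView d | vertexView d
    ... | left j l | _ = ⊥-elim (Left⇒onLoop l off)
    ... | notLeft _ | onLoop j o' = ⊥-elim (off j o')
    ... | notLeft _ | offLoop _ = refl

  loopIndex̃-out : ∀ i → loopIndex̃ (out i) ≡ just i
  loopIndex̃-out i = loopIndex̃-onLoop (λ j l → Left⇒notOut l i refl) Orb-refl

  loopIndex̃-inn : ∀ i → loopIndex̃ (inn i) ≡ just i
  loopIndex̃-inn i = loopIndex̃-onLoop (λ j l → Left⇒notInn l i refl) (Orb-out-inn i)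

  loopIndex̃-σ̃-out : ∀ i → loopIndex̃ (σ̃ (out i)) ≡ just i
  loopIndex̃-σ̃-out i with Left-σ-out (shift ε i)
  ... | inj₁ l = begin
    loopIndex̃ (σ̃ (out i))                   ≡⟨ cong loopIndex̃ (σ̃-out i) ⟩
    loopIndex̃ (cycleAlong inn (neg ε) x)
      ≡⟨ cong loopIndex̃ (cycleAlong-outside inn inn-injective (neg ε) (Left⇒notInn l)) ⟩
    loopIndex̃ x                             ≡⟨ loopIndex̃-Left l ⟩
    just (shift (neg ε) (shift ε i))         ≡⟨ cong just (shift-shift-neg ε i) ⟩
    just i                                   ∎
    where
    open ≡-Reasoning
    x = σ M (out (shift ε i))
  ... | inj₂ x≡inn = begin
    loopIndex̃ (σ̃ (out i))                   ≡⟨ cong loopIndex̃ (σ̃-out i) ⟩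
    loopIndex̃ (cycleAlong inn (neg ε) x)     ≡⟨ cong (loopIndex̃ ∘ cycleAlong inn (neg ε)) x≡inn ⟩
    loopIndex̃ (cycleAlong inn (neg ε) (inn (shift ε i)))
      ≡⟨ cong loopIndex̃ (cycleAlong-image inn inn-injective (neg ε) (shift ε i)) ⟩
    loopIndex̃ (inn (shift (neg ε) (shift ε i))) ≡⟨ cong (loopIndex̃ ∘ inn) (shift-shift-neg ε i) ⟩
    loopIndex̃ (inn i)                       ≡⟨ loopIndex̃-inn i ⟩
    just i                                   ∎
    where
    open ≡-Reasoning
    x = σ M (out (shift ε i))

  loopIndex̃-σ̃-Left : ∀ {j d} → Left j d → loopIndex̃ (σ̃ d) ≡ loopIndex̃ d
  loopIndex̃-σ̃-Left {j} {d} l with Left-σ l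
  ... | inj₁ l′ = trans (cong loopIndex̃ (σ̃-unchanged d (Left⇒notOut l) (Left⇒notInn l′)))
                        (trans (loopIndex̃-Left l′) (sym (loopIndex̃-Left l)))
  ... | inj₂ σd≡inn = trans (cong loopIndex̃ (σ̃-before-inn d j (Left⇒notOut l) (sym σd≡inn)))
                            (trans (loopIndex̃-inn _) (sym (loopIndex̃-Left l)))

  loopIndex̃-σ̃ : ∀ d → loopIndex̃ (σ̃ d) ≡ loopIndex̃ d
  loopIndex̃-σ̃ d with vertexView d
  ... | offLoop off = trans (cong loopIndex̃ (OffLoop⇒σ̃≡σ off))
                            (trans (loopIndex̃-offLoop (OffLoop-σ off)) (sym (loopIndex̃-offLoop off)))
  ... | onLoop i o with out i Finₚ.≟ d
  ...   | yes refl = trans (loopIndex̃-σ̃-out i) (sym (loopIndex̃-out i))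
  ...   | no out≢d with leftView d
  ...     | left j l   = loopIndex̃-σ̃-Left l
  ...     | notLeft nl = trans (cong loopIndex̃ (Plain⇒σ̃≡σ p))
                               (trans (loopIndex̃-onLoop (Plain⇒σ-notLeft p) (Orb-trans o (1 , refl)))
                                      (sym (loopIndex̃-onLoop nl o)))
    where
    p : Plain d
    p = (λ j e → out≢d (trans (cong out (loopVertex-unique o (0 , e))) e)) , nl

  loopIndex̃-iter : ∀ t x → loopIndex̃ (iter σ̃ t x) ≡ loopIndex̃ x
  loopIndex̃-iter zero x = refl
  loopIndex̃-iter (suc t) x = trans (loopIndex̃-σ̃ _) (loopIndex̃-iter t x)

  loopIndex̃-Orb̃ : ∀ {x y} → Orb σ̃ x y → loopIndex̃ x ≡ loopIndex̃ y
  loopIndex̃-Orb̃ {x} (t , refl) = sym (loopIndex̃-iter t x)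

  loopIndex̃-just : ∀ {x j} → loopIndex̃ x ≡ just j → Orb σ̃ (out j) x
  loopIndex̃-just {x} {j} e with vertexView x
  ... | offLoop off = case trans (sym e) (loopIndex̃-offLoop off) of λ ()
  ... | onLoop i o with Orb-out-split o
  ...   | inj₁ (l , o') = subst (λ z → Orb σ̃ (out z) x) (just-injective (trans (sym (loopIndex̃-Left l)) e)) o'
  ...   | inj₂ (nl , o') = subst (λ z → Orb σ̃ (out z) x) (just-injective (trans (sym (loopIndex̃-onLoop nl o)) e)) o'

  loopIndex̃-nothing : ∀ {x} → loopIndex̃ x ≡ nothing → OffLoop x
  loopIndex̃-nothing {x} e i o with leftView x
  ... | left j l   = case trans (sym e) (loopIndex̃-Left l) of λ ()
  ... | notLeft nl = case trans (sym e) (loopIndex̃-onLoop nl o) of λ ()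

  IsSimple-M̃ : IsSimple M̃ γ
  IsSimple-M̃ i j o = just-injective (trans (sym (loopIndex̃-out i)) (trans (loopIndex̃-Orb̃ o) (loopIndex̃-out j)))

  IsLoop-M̃ : IsLoop M̃ γ
  IsLoop-M̃ i = subst (λ z → Orb σ̃ z (out (rot 1 i))) (sym (α-out i)) (Orb̃-inn-out (shift plus i))

  opaque
    rep : Fin D → Fin D
    rep d with vertexView d
    ... | onLoop i _ = out i
    ... | offLoop _ = d

    rep-onLoop : ∀ {i d} → Orb (σ M) (out i) d → rep d ≡ out i
    rep-onLoop {i} {d} o with vertexView d
    ... | onLoop j o' = cong out (loopVertex-unique o' o)
    ... | offLoop off = ⊥-elim (off i o)

    rep-offLoop : ∀ {d} → OffLoop d → rep d ≡ d
    rep-offLoop {d} off with vertexView d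
    ... | onLoop j o' = ⊥-elim (off j o')
    ... | offLoop _ = refl

  rep̃ : Fin D → Fin D
  rep̃ x = maybe′ out x (loopIndex̃ x)

  rep-Orb : ∀ {d e} → Orb (σ M) d e → Orb σ̃ (rep d) (rep e)
  rep-Orb {d} {e} oe with vertexView d | vertexView e
  ... | onLoop i o | onLoop j o' rewrite rep-onLoop o | rep-onLoop o' | loopVertex-unique o' (Orb-trans o oe) = Orb-refl
  ... | onLoop i o | offLoop off = ⊥-elim (off i (Orb-trans o oe))
  ... | offLoop off | onLoop j o' = ⊥-elim (off j (Orb-trans o' (Orb-sym oe)))
  ... | offLoop off | offLoop off' rewrite rep-offLoop off | rep-offLoop off' = OffLoop-Orb→ off oe

  rep̃-Orb : ∀ {x y} → Orb σ̃ x y → Orb (σ M) (rep̃ x) (rep̃ y)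
  rep̃-Orb {x} {y} o with loopIndex̃ x in ex | loopIndex̃ y in ey
  ... | just j | just j' with trans (sym ex) (trans (loopIndex̃-Orb̃ o) ey)
  ... | refl = Orb-refl
  rep̃-Orb {x} {y} o | just j | nothing with trans (sym ex) (trans (loopIndex̃-Orb̃ o) ey)
  ... | ()
  rep̃-Orb {x} {y} o | nothing | just j with trans (sym ex) (trans (loopIndex̃-Orb̃ o) ey)
  ... | ()
  rep̃-Orb {x} {y} o | nothing | nothing = OffLoop-Orb← (loopIndex̃-nothing ex) o

  rep̃-rep : ∀ d → Orb (σ M) (rep̃ (rep d)) d
  rep̃-rep d with vertexView d
  ... | onLoop i o rewrite rep-onLoop o | loopIndex̃-out i = o
  ... | offLoop off rewrite rep-offLoop off | loopIndex̃-offLoop off = Orb-refl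

  rep-rep̃ : ∀ x → Orb σ̃ (rep (rep̃ x)) x
  rep-rep̃ x with loopIndex̃ x in ex
  ... | just j rewrite rep-onLoop {j} {out j} Orb-refl = loopIndex̃-just ex
  ... | nothing rewrite rep-offLoop (loopIndex̃-nothing ex) = Orb-refl

  vertexCorrespondence : OrbitCorrespondence (σ M) σ̃
  vertexCorrespondence = record
    { to = rep ; from = rep̃ ; to-Orb = rep-Orb ; from-Orb = rep̃-Orb ; from-to = rep̃-rep ; to-from = rep-rep̃ }

  numVertices-M̃ : numVertices M̃ ≡ numVertices M
  numVertices-M̃ = sym (numOrbits-≡ σ-perm σ̃-perm vertexCorrespondence)

  Joined̃ : Fin D → Fin D → Set
  Joined̃ d e = Reach M̃ d e × Reach M̃ e d

  Joined̃-sym : ∀ {d e} → Joined̃ d e → Joined̃ e d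
  Joined̃-sym (p , q) = q , p

  Joined̃-trans : ∀ {a b c} → Joined̃ a b → Joined̃ b c → Joined̃ a c
  Joined̃-trans (p , q) (p' , q') = Reach-trans p p' , Reach-trans q' q

  Orb̃⇒Joined̃ : ∀ {d e} → Orb σ̃ d e → Joined̃ d e
  Orb̃⇒Joined̃ o = Orb⇒Reach M̃ o , Orb⇒Reach M̃ (Orb̃-sym o)

  Joined̃-α : ∀ d → Joined̃ d (α M d)
  Joined̃-α d = viaα here , viaα (subst (λ z → Reach M̃ z d) (sym (α-invol d)) here)

  Joined̃-out-prev : ∀ i → Joined̃ (out (shift minus i)) (out i)
  Joined̃-out-prev i = Joined̃-trans (Joined̃-α (out (shift minus i))) (Orb̃⇒Joined̃ (Orb̃-inn-out i))

  Joined̃-out-shift : ∀ s i → Joined̃ (out (shift s i)) (out i)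
  Joined̃-out-shift minus i = Joined̃-out-prev i
  Joined̃-out-shift plus  i =
    Joined̃-sym (subst (λ z → Joined̃ (out z) (out (shift plus i))) (shift-shift-neg plus i) (Joined̃-out-prev (shift plus i)))

  Joined̃-onLoop : ∀ {i x} → Orb (σ M) (out i) x → Joined̃ (out i) x
  Joined̃-onLoop {i} o with Orb-out-split o
  ... | inj₁ (_ , o') = Joined̃-trans (Joined̃-sym (Joined̃-out-shift (neg ε) i)) (Orb̃⇒Joined̃ o')
  ... | inj₂ (_ , o') = Orb̃⇒Joined̃ o'

  Joined̃-σ : ∀ d → Joined̃ d (σ M d)
  Joined̃-σ d with vertexView d
  ... | onLoop i o = Joined̃-trans (Joined̃-sym (Joined̃-onLoop o)) (Joined̃-onLoop (Orb-trans o (1 , refl)))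
  ... | offLoop off = Orb̃⇒Joined̃ (1 , OffLoop⇒σ̃≡σ off)

  Reach-M̃ : ∀ {d e} → Reach M d e → Reach M̃ d e
  Reach-M̃ here = here
  Reach-M̃ {d} (viaσ r) = Reach-trans (proj₁ (Joined̃-σ d)) (Reach-M̃ r)
  Reach-M̃ (viaα r) = viaα (Reach-M̃ r)

  IsMap-M̃ : IsMap M̃
  IsMap-M̃ = record
    { σ-perm = σ̃-perm ; α-invol = α-invol ; α-fpf = α-fpf ; connected = λ d e → Reach-M̃ (connected d e) }

  corner : Fin D → Fin D
  corner = cycleAlong out (neg ε)

  σ̃-corner : ∀ c → σ̃ (corner c) ≡ cycleAlong inn (neg ε) (σ M c)
  σ̃-corner c with findView out c
  ... | found i refl _ = trans (cong σ̃ (cycleAlong-image out out-injective (neg ε) i)) (σ̃-out′ i)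
  ... | notFound h _ = trans (cong σ̃ (cycleAlong-outside out out-injective (neg ε) h)) (σ̃-notOut c h)

  corner-φ : ∀ c → corner (φ M c) ≡ φ M̃ (corner c)
  corner-φ c with findView inn (σ M c)
  ... | found j e _ = begin
        corner (α M (σ M c))           ≡⟨ cong (corner ∘ α M) (sym e) ⟩
        corner (α M (inn j))           ≡⟨ cong corner (α-inn j) ⟩
        corner (out (shift minus j))   ≡⟨ cycleAlong-image out out-injective (neg ε) _ ⟩
        out (shift (neg ε) (shift minus j)) ≡⟨ cong out (shift-comm (neg ε) minus j) ⟩
        out (shift minus (shift (neg ε) j)) ≡⟨ sym (α-inn (shift (neg ε) j)) ⟩
        α M (inn (shift (neg ε) j)) ≡⟨ cong (α M) (sym (cycleAlong-image inn inn-injective (neg ε) j)) ⟩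
        α M (cycleAlong inn (neg ε) (inn j)) ≡⟨ cong (α M ∘ cycleAlong inn (neg ε)) e ⟩
        α M (cycleAlong inn (neg ε) (σ M c)) ≡⟨ cong (α M) (sym (σ̃-corner c)) ⟩
        α M (σ̃ (corner c)) ∎
    where open ≡-Reasoning
  ... | notFound h _ = trans (cycleAlong-outside out out-injective (neg ε) nout)
          (cong (α M) (trans (sym (cycleAlong-outside inn inn-injective (neg ε) h)) (sym (σ̃-corner c))))
    where
    nout : ∀ j → out j ≢ α M (σ M c)
    nout j e = h (shift plus j) (trans (sym (α-out j)) (trans (cong (α M) e) (α-invol _)))

  φ̃-perm : IsPerm (φ M̃)
  φ̃-perm = IsPerm-∘ (α M , α-invol , α-invol) σ̃-perm

  corner-perm : IsPerm corner
  corner-perm = cycleAlong-perm out out-injective (neg ε)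

  open Conjugate (Walks.φ-perm M σ-perm α-invol) φ̃-perm corner-perm corner-φ

  faceDeg-M̃-corner : ∀ d → faceDeg M̃ (corner d) ≡ faceDeg M d
  faceDeg-M̃-corner = orbitSize-conj

  faceDeg-M̃-cornerMap : ∀ d → faceDeg M̃ (cornerMap M γ ε d) ≡ faceDeg M d
  faceDeg-M̃-cornerMap d = trans (cong (faceDeg M̃) (cornerMap≡cycleAlong d)) (faceDeg-M̃-corner d)

  faceDeg-M̃ : ∀ d → faceDeg M̃ d ≡ faceDeg M (proj₁ corner-perm d)
  faceDeg-M̃ d = trans (cong (faceDeg M̃) (sym (proj₂ (proj₂ corner-perm) d))) (orbitSize-conj (proj₁ corner-perm d))

  SameFace-cornerMap⇔ : ∀ d e → SameFace M d e ⇔ SameFace M̃ (cornerMap M γ ε d) (cornerMap M γ ε e)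
  SameFace-cornerMap⇔ d e =
    subst₂ (λ x y → SameFace M d e ⇔ SameFace M̃ x y) (sym (cornerMap≡cycleAlong d)) (sym (cornerMap≡cycleAlong e)) Orb-conj⇔

  numFaces-M̃ : numFaces M̃ ≡ numFaces M
  numFaces-M̃ = sym numOrbits-conj

  cornerMap-involutive : ∀ d → cornerMap M̃ γ (neg ε) (cornerMap M γ ε d) ≡ d
  cornerMap-involutive d = begin
    cornerMap M̃ γ (neg ε) (cornerMap M γ ε d)            ≡⟨ Reglue.cornerMap≡cycleAlong M̃ γ (neg ε) _ ⟩
    cycleAlong out (neg (neg ε)) (cornerMap M γ ε d)      ≡⟨ cong (cycleAlong out (neg (neg ε))) (cornerMap≡cycleAlong d) ⟩
    cycleAlong out (neg (neg ε)) (cycleAlong out (neg ε) d) ≡⟨ cycleAlong-neg out out-injective (neg ε) d ⟩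
    d                                                    ∎
    where open ≡-Reasoning

  Φ-involutive : TripleIso (Φ (Φ ⟨ M , γ , ε ⟩)) ⟨ M , γ , ε ⟩
  Φ-involutive = record
    { π      = λ d → d
    ; π-perm = (λ d → d) , (λ _ → refl) , (λ _ → refl)
    ; π-σ    = Φσ-involutive
    ; π-α    = λ _ → refl
    ; π-root = cornerMap-involutive (root M)
    ; π-len  = refl
    ; π-loop = λ i → cong (darts γ) (sym (Finₚ.cast-is-id _ i))
    ; π-sign = neg-involutive ε
    }

-- A walk of M becomes a walk of M̃ once every dart that changed vertex is reached, or left, through the
-- dart of M̃ joining the vertices of γ_{i∓1} and γ_i.
module Translation {D : ℕ} (M : RawMap D) (γ : Loop D) (ε : Sign) (isMap : IsMap M)
  (loop : IsLoop M γ) (simple : IsSimple M γ) (inn≢out : ∀ i j → Reglue.inn M γ ε i ≢ Reglue.out M γ ε j) where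

  open Reglued M γ ε isMap loop simple inn≢out
  open IsMap isMap using (σ-perm; α-invol)
  open Walks M σ-perm α-invol
    using (Walk; Walk-split; Walk-sameDarts; ClosedPath⇒Walk; faceWalkUpTo; faceWalkUpTo-suc; Walk-faceWalk)
  open Walks M̃ σ̃-perm α-invol using () renaming
    ( Walk to Walk̃ ; Walk-≡ to Walk̃-≡ ; Walk-++ to Walk̃-++ ; Walk-startOrb to Walk̃-startOrb
    ; Walk-faceWalk to Walk̃-faceWalk ; faceWalkUpTo to faceWalkUpTõ ; faceWalkUpTo-suc to faceWalkUpTõ-suc
    ; Walk-faceWalkUpTo to Walk̃-faceWalkUpTo ; PathHomotopic to PH̃ ; PathHomotopic-setoid to PH̃-setoid
    ; PathHomotopic⇒Homotopic to PH̃⇒Homotopic ; ph-refl to ph̃-refl ; ph-≡ to ph̃-≡ ; ph-sym to ph̃-sym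
    ; ph-trans to ph̃-trans ; ph-delete to ph̃-delete ; ph-backtrack to ph̃-backtrack ; ph-backtrack′ to ph̃-backtrack′
    ; ph-wrap to ph̃-wrap ; ph-++ʳ to ph̃-++ʳ ; ph-++ˡ to ph̃-++ˡ ; ph-moveEnds to ph̃-moveEnds
    ; ph-cancelˡ to ph̃-cancelˡ ; Cancelling to Cancelling̃ ; ph-cancel to ph̃-cancel )

  link : Sign → Fin (suc n) → Fin D
  link plus i = out (shift minus i)
  link minus i = α M (out i)

  link-tail : ∀ s i → Orb σ̃ (out (shift (neg s) i)) (link s i)
  link-tail plus i = Orb-refl
  link-tail minus i = subst (Orb σ̃ (out (shift plus i))) (sym (α-out i)) (Orb̃-sym (Orb̃-inn-out (shift plus i)))

  link-head : ∀ s i → Orb σ̃ (α M (link s i)) (out i)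
  link-head plus i = Orb̃-inn-out i
  link-head minus i = subst (λ z → Orb σ̃ z (out i)) (sym (α-invol (out i))) Orb-refl

  opaque
    prefix : Fin D → List (Fin D)
    prefix y with leftView y
    ... | left i _ = α M (link ε i) ∷ []
    ... | notLeft _ = []

    prefix-Left : ∀ {i y} → Left i y → prefix y ≡ α M (link ε i) ∷ []
    prefix-Left {i} {y} l with leftView y
    ... | left j l' = cong (λ z → α M (link ε z) ∷ []) (Left-unique l' l)
    ... | notLeft h = ⊥-elim (h i l)

    prefix-notLeft : ∀ {y} → (∀ i → ¬ Left i y) → prefix y ≡ []
    prefix-notLeft {y} h with leftView y
    ... | left j l' = ⊥-elim (h j l')
    ... | notLeft _ = refl

    suffix : Fin D → List (Fin D)
    suffix y with leftView (α M y)
    ... | left j _ = link ε j ∷ []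
    ... | notLeft _ = []

    suffix-Left : ∀ {j y} → Left j (α M y) → suffix y ≡ link ε j ∷ []
    suffix-Left {j} {y} l with leftView (α M y)
    ... | left j' l' = cong (λ z → link ε z ∷ []) (Left-unique l' l)
    ... | notLeft h = ⊥-elim (h j l)

    suffix-notLeft : ∀ {y} → (∀ i → ¬ Left i (α M y)) → suffix y ≡ []
    suffix-notLeft {y} h with leftView (α M y)
    ... | left j l' = ⊥-elim (h j l')
    ... | notLeft _ = refl

    bridge : Fin D → List (Fin D)
    bridge c with leftView c
    ... | left i _ = link ε i ∷ []
    ... | notLeft _ with findView out c
    ...   | found i _ _ = link ε i ∷ []
    ...   | notFound _ _ = []

    bridge-Left : ∀ {i c} → Left i c → bridge c ≡ link ε i ∷ []
    bridge-Left {i} {c} l with leftView c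
    ... | left j l' = cong (λ z → link ε z ∷ []) (Left-unique l' l)
    ... | notLeft h = ⊥-elim (h i l)

    bridge-out : ∀ i → bridge (out i) ≡ link ε i ∷ []
    bridge-out i with leftView (out i)
    ... | left j l' = ⊥-elim (Left⇒notOut l' i refl)
    ... | notLeft _ with findView out (out i)
    ...   | found j e _ = cong (λ z → link ε z ∷ []) (out-injective e)
    ...   | notFound h _ = ⊥-elim (h i refl)

    bridge-plain : ∀ {c} → (∀ i → ¬ Left i c) → (∀ i → out i ≢ c) → bridge c ≡ []
    bridge-plain {c} h h' with leftView c
    ... | left j l' = ⊥-elim (h j l')
    ... | notLeft _ with findView out c
    ...   | found j e _ = ⊥-elim (h' j e)
    ...   | notFound _ _ = refl

  translateDart : Fin D → List (Fin D)
  translateDart y = prefix y ++ y ∷ suffix y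

  translate : List (Fin D) → List (Fin D)
  translate [] = []
  translate (y ∷ ys) = translateDart y ++ translate ys

  translate-++ : ∀ u v → translate (u ++ v) ≡ translate u ++ translate v
  translate-++ [] v = refl
  translate-++ (y ∷ u) v =
    trans (cong (translateDart y ++_) (translate-++ u v)) (sym (++-assoc (translateDart y) (translate u) (translate v)))

  Orb̃-rep-notLeft : ∀ {x} → (∀ i → ¬ Left i x) → Orb σ̃ (rep x) x
  Orb̃-rep-notLeft {x} nl with vertexView x
  ... | onLoop i o with Orb-out-split o
  ...   | inj₁ (l , _) = ⊥-elim (nl i l)
  ...   | inj₂ (_ , o') = subst (λ z → Orb σ̃ z x) (sym (rep-onLoop o)) o'
  Orb̃-rep-notLeft {x} nl | offLoop off = subst (λ z → Orb σ̃ z x) (sym (rep-offLoop off)) Orb-refl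

  Left⇒Orb̃ : ∀ {i x} → Left i x → Orb σ̃ (out (shift (neg ε) i)) x
  Left⇒Orb̃ l with Orb-out-split (Left⇒Orb l)
  ... | inj₁ (_ , o) = o
  ... | inj₂ (nl , _) = ⊥-elim (nl _ l)

  Left⇒Orb̃-link : ∀ {i x} → Left i x → Orb σ̃ x (link ε i)
  Left⇒Orb̃-link l = Orb-trans (Orb̃-sym (Left⇒Orb̃ l)) (link-tail ε _)

  Walk̃-prefix : ∀ y → Walk̃ (rep y) (prefix y) y
  Walk̃-prefix y = case leftView y of λ where
    (left i l)   → Walk̃-≡ (sym (prefix-Left l))
      (subst (λ z → Walk̃ z (α M (link ε i) ∷ []) y) (sym (rep-onLoop (Left⇒Orb l)))
        (Orb̃-sym (link-head ε i) , subst (λ z → Orb σ̃ z y) (sym (α-invol (link ε i))) (Orb̃-sym (Left⇒Orb̃-link l))))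
    (notLeft nl) → Walk̃-≡ (sym (prefix-notLeft nl)) (Orb̃-rep-notLeft nl)

  Walk̃-suffix : ∀ y → Walk̃ (α M y) (suffix y) (rep (α M y))
  Walk̃-suffix y = case leftView (α M y) of λ where
    (left j l)   → Walk̃-≡ (sym (suffix-Left l))
      (subst (Walk̃ (α M y) (link ε j ∷ [])) (sym (rep-onLoop (Left⇒Orb l))) (Left⇒Orb̃-link l , link-head ε j))
    (notLeft nl) → Walk̃-≡ (sym (suffix-notLeft nl)) (Orb̃-sym (Orb̃-rep-notLeft nl))

  Walk̃-translateDart : ∀ y → Walk̃ (rep y) (translateDart y) (rep (α M y))
  Walk̃-translateDart y = Walk̃-++ (Walk̃-prefix y) (Orb-refl , Walk̃-suffix y)

  Walk̃-translate : ∀ {s w t} → Walk s w t → Walk̃ (rep s) (translate w) (rep t)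
  Walk̃-translate {w = []} o = rep-Orb o
  Walk̃-translate {w = y ∷ ys} (o , w) = Walk̃-startOrb (rep-Orb o) (Walk̃-++ (Walk̃-translateDart y) (Walk̃-translate w))

  Walk̃-bridge-out : ∀ i → Walk̃ (corner (out i)) (bridge (out i)) (rep (out i))
  Walk̃-bridge-out i =
    subst₂ (λ s t → Walk̃ s (bridge (out i)) t)
      (sym (cycleAlong-image out out-injective (neg ε) i)) (sym (rep-onLoop Orb-refl))
      (Walk̃-≡ (sym (bridge-out i)) (link-tail ε i , link-head ε i))

  Walk̃-bridge-notOut : ∀ {c} → (∀ i → out i ≢ c) → Walk̃ (corner c) (bridge c) (rep c)
  Walk̃-bridge-notOut {c} c∉ = subst (λ s → Walk̃ s (bridge c) (rep c)) (sym (cycleAlong-outside out out-injective (neg ε) c∉))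
    (case leftView c of λ where
      (left i l)   → subst (Walk̃ c (bridge c)) (sym (rep-onLoop (Left⇒Orb l)))
                       (Walk̃-≡ (sym (bridge-Left l)) (Left⇒Orb̃-link l , link-head ε i))
      (notLeft nl) → Walk̃-≡ (sym (bridge-plain nl c∉)) (Orb̃-sym (Orb̃-rep-notLeft nl)))

  Walk̃-bridge : ∀ c → Walk̃ (corner c) (bridge c) (rep c)
  Walk̃-bridge c = case findView out c of λ where
    (found i e _)   → subst (λ z → Walk̃ (corner z) (bridge z) (rep z)) e (Walk̃-bridge-out i)
    (notFound c∉ _) → Walk̃-bridge-notOut c∉

  suffix≡bridge : ∀ y → (∀ j → out j ≢ α M y) → suffix y ≡ bridge (α M y)
  suffix≡bridge y h with leftView (α M y)
  ... | left j l = trans (suffix-Left l) (sym (bridge-Left l))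
  ... | notLeft nl = trans (suffix-notLeft nl) (sym (bridge-plain nl h))

  notInn⇒α-notOut : ∀ {y} → (∀ j → inn j ≢ y) → ∀ j → out j ≢ α M y
  notInn⇒α-notOut {y} h j e = h (shift plus j) (trans (sym (α-out j)) (trans (cong (α M) e) (α-invol y)))

  ph-link-square : ∀ s i {a b} → Walk̃ a (link s i ∷ inn i ∷ []) b →
    Walk̃ a (inn (shift (neg s) i) ∷ link s (shift minus i) ∷ []) b →
    PH̃ a b (link s i ∷ inn i ∷ []) (inn (shift (neg s) i) ∷ link s (shift minus i) ∷ [])
  ph-link-square plus  i wL wR = ph̃-trans (ph̃-backtrack [] (out (shift minus i)) [] wL)
                                          (ph̃-sym (ph̃-backtrack′ [] (out (shift minus (shift minus i))) [] wR))
  ph-link-square minus i wL wR = ph̃-≡ (cong (λ z → α M (out z) ∷ inn i ∷ []) (sym (shift-shift-neg plus i)))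

  BridgeSquare : Fin D → Set
  BridgeSquare c =
    Walk̃ (corner c) (bridge c ++ translateDart (σ M c)) (rep (φ M c)) →
    Walk̃ (corner c) (σ̃ (corner c) ∷ bridge (φ M c)) (rep (φ M c)) →
    PH̃ (corner c) (rep (φ M c)) (bridge c ++ translateDart (σ M c)) (σ̃ (corner c) ∷ bridge (φ M c))

  bridge-square-onLoop : ∀ {c} i → bridge c ≡ link ε i ∷ [] → Left i (σ M c) ⊎ σ M c ≡ inn i → BridgeSquare c
  bridge-square-onLoop {c} i bridge≡ (inj₁ l) wL wR =
    subst₂ (PH̃ _ _) (sym eqL) (sym eqR) (ph̃-backtrack [] (link ε i) (σ M c ∷ suffix (σ M c)) (Walk̃-≡ eqL wL))
    where
    eqL : bridge c ++ translateDart (σ M c) ≡ link ε i ∷ α M (link ε i) ∷ σ M c ∷ suffix (σ M c)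
    eqL = cong₂ (λ x y → x ++ y ++ σ M c ∷ suffix (σ M c)) bridge≡ (prefix-Left l)
    eqR : σ̃ (corner c) ∷ bridge (φ M c) ≡ σ M c ∷ suffix (σ M c)
    eqR = cong₂ _∷_ (trans (σ̃-corner c) (cycleAlong-outside inn inn-injective (neg ε) (Left⇒notInn l)))
                    (sym (suffix≡bridge (σ M c) (notInn⇒α-notOut (Left⇒notInn l))))
  bridge-square-onLoop {c} i bridge≡ (inj₂ e) wL wR =
    subst₂ (PH̃ _ _) (sym eqL) (sym eqR) (ph-link-square ε i (Walk̃-≡ eqL wL) (Walk̃-≡ eqR wR))
    where
    open ≡-Reasoning
    eqL : bridge c ++ translateDart (σ M c) ≡ link ε i ∷ inn i ∷ []
    eqL = begin
      bridge c ++ translateDart (σ M c)  ≡⟨ cong₂ (λ x y → x ++ translateDart y) bridge≡ e ⟩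
      link ε i ∷ translateDart (inn i)
        ≡⟨ cong (λ z → link ε i ∷ z ++ inn i ∷ suffix (inn i)) (prefix-notLeft (λ j l → Left⇒notInn l i refl)) ⟩
      link ε i ∷ inn i ∷ suffix (inn i)
        ≡⟨ cong (λ z → link ε i ∷ inn i ∷ z) (suffix-notLeft (λ j l → Left⇒notOut l (shift minus i) (sym (α-inn i)))) ⟩
      link ε i ∷ inn i ∷ []              ∎
    eqR : σ̃ (corner c) ∷ bridge (φ M c) ≡ inn (shift (neg ε) i) ∷ link ε (shift minus i) ∷ []
    eqR = cong₂ _∷_
      (trans (σ̃-corner c) (trans (cong (cycleAlong inn (neg ε)) e) (cycleAlong-image inn inn-injective (neg ε) i)))
      (trans (cong (λ z → bridge (α M z)) e) (trans (cong bridge (α-inn i)) (bridge-out (shift minus i))))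

  bridge-square-plain : ∀ {c} → Plain c → BridgeSquare c
  bridge-square-plain {c} p@(c∉ , nl) _ _ = ph̃-≡ (trans eqL (sym eqR))
    where
    eqL : bridge c ++ translateDart (σ M c) ≡ σ M c ∷ suffix (σ M c)
    eqL = cong₂ (λ x y → x ++ y ++ σ M c ∷ suffix (σ M c)) (bridge-plain nl c∉) (prefix-notLeft (Plain⇒σ-notLeft p))
    eqR : σ̃ (corner c) ∷ bridge (φ M c) ≡ σ M c ∷ suffix (σ M c)
    eqR = cong₂ _∷_ (trans (σ̃-corner c) (cycleAlong-outside inn inn-injective (neg ε) (Plain⇒σ-notInn p)))
                    (sym (suffix≡bridge (σ M c) (notInn⇒α-notOut (Plain⇒σ-notInn p))))

  bridge-square : ∀ c → BridgeSquare c
  bridge-square c = case findView out c of λ where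
    (found i e _)   → subst BridgeSquare e (bridge-square-onLoop i (bridge-out i) (Left-σ-out i))
    (notFound c∉ _) → case leftView c of λ where
      (left i l)   → bridge-square-onLoop i (bridge-Left l) (Left-σ l)
      (notLeft nl) → bridge-square-plain (c∉ , nl)

  module _ (d : Fin D) where
    private
      c : ℕ → Fin D
      c k = iter (φ M) k d

      iter-φ̃-corner : ∀ k → iter (φ M̃) k (corner d) ≡ corner (c k)
      iter-φ̃-corner k = sym (iter-conj corner corner-φ k d)

      translate-faceWalkUpTo-suc : ∀ k → bridge d ++ translate (faceWalkUpTo d (suc k)) ≡
        (bridge d ++ translate (faceWalkUpTo d k)) ++ translateDart (σ M (c k))
      translate-faceWalkUpTo-suc k = begin
        bridge d ++ translate (faceWalkUpTo d (suc k))    ≡⟨ cong (λ z → bridge d ++ translate z) (faceWalkUpTo-suc d k) ⟩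
        bridge d ++ translate (Fₖ ++ y ∷ [])              ≡⟨ cong (bridge d ++_) (translate-++ Fₖ (y ∷ [])) ⟩
        bridge d ++ translate Fₖ ++ translateDart y ++ [] ≡⟨ cong (λ z → bridge d ++ translate Fₖ ++ z) (++-identityʳ _) ⟩
        bridge d ++ translate Fₖ ++ translateDart y       ≡⟨ sym (++-assoc (bridge d) _ (translateDart y)) ⟩
        (bridge d ++ translate Fₖ) ++ translateDart y     ∎
        where
        open ≡-Reasoning
        y = σ M (c k)
        Fₖ = faceWalkUpTo d k

      faceWalkUpTõ-suc-corner : ∀ k → faceWalkUpTõ (corner d) k ++ (σ̃ (corner (c k)) ∷ bridge (c (suc k))) ≡
        faceWalkUpTõ (corner d) (suc k) ++ bridge (c (suc k))
      faceWalkUpTõ-suc-corner k = begin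
        F̃ₖ ++ (σ̃ (corner (c k)) ∷ B)                  ≡⟨ cong (λ z → F̃ₖ ++ (σ̃ z ∷ B)) (sym (iter-φ̃-corner k)) ⟩
        F̃ₖ ++ (σ̃ (iter (φ M̃) k (corner d)) ∷ []) ++ B  ≡⟨ sym (++-assoc F̃ₖ _ B) ⟩
        (F̃ₖ ++ σ̃ (iter (φ M̃) k (corner d)) ∷ []) ++ B  ≡⟨ cong (_++ B) (sym (faceWalkUpTõ-suc (corner d) k)) ⟩
        faceWalkUpTõ (corner d) (suc k) ++ B          ∎
        where
        open ≡-Reasoning
        F̃ₖ = faceWalkUpTõ (corner d) k
        B = bridge (c (suc k))


    -- Each bridge-square trades one translated side of the face of d for one side of the face of corner d in M̃.
    ph-translate-faceWalkUpTo : ∀ k → PH̃ (corner d) (rep (c k))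
      (bridge d ++ translate (faceWalkUpTo d k)) (faceWalkUpTõ (corner d) k ++ bridge (c k))
    ph-translate-faceWalkUpTo zero    = ph̃-≡ (++-identityʳ (bridge d))
    ph-translate-faceWalkUpTo (suc k) = begin
      bridge d ++ translate (faceWalkUpTo d (suc k))               ≡⟨ translate-faceWalkUpTo-suc k ⟩
      (bridge d ++ translate (faceWalkUpTo d k)) ++ translateDart y ≈⟨ ph̃-++ʳ (ph-translate-faceWalkUpTo k) w-y ⟩
      (F̃ₖ ++ bridge (c k)) ++ translateDart y                      ≡⟨ ++-assoc F̃ₖ (bridge (c k)) (translateDart y) ⟩
      F̃ₖ ++ (bridge (c k) ++ translateDart y)                      ≈⟨ ph̃-++ˡ w-F̃ₖ (bridge-square (c k) w-left w-right) ⟩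
      F̃ₖ ++ (σ̃ (corner (c k)) ∷ bridge (c (suc k)))                ≡⟨ faceWalkUpTõ-suc-corner k ⟩
      faceWalkUpTõ (corner d) (suc k) ++ bridge (c (suc k))         ∎
      where
      open Reasoning (PH̃-setoid (corner d) (rep (c (suc k))))
      y = σ M (c k)
      F̃ₖ = faceWalkUpTõ (corner d) k

      w-y : Walk̃ (rep (c k)) (translateDart y) (rep (c (suc k)))
      w-y = Walk̃-startOrb (rep-Orb (1 , refl)) (Walk̃-translateDart y)
      w-left : Walk̃ (corner (c k)) (bridge (c k) ++ translateDart y) (rep (c (suc k)))
      w-left = Walk̃-++ (Walk̃-bridge (c k)) w-y
      w-right : Walk̃ (corner (c k)) (σ̃ (corner (c k)) ∷ bridge (c (suc k))) (rep (c (suc k)))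
      w-right = (1 , refl) , subst (λ z → Walk̃ z (bridge (c (suc k))) (rep (c (suc k)))) (corner-φ (c k))
                                     (Walk̃-bridge (c (suc k)))
      w-F̃ₖ : Walk̃ (corner d) F̃ₖ (corner (c k))
      w-F̃ₖ = subst (Walk̃ (corner d) F̃ₖ) (iter-φ̃-corner k) (Walk̃-faceWalkUpTo (corner d) k)

    ph-translate-faceWalk : PH̃ (rep d) (rep d) (translate (faceWalk M d)) []
    ph-translate-faceWalk =
      ph̃-cancelˡ (bridge d) (Walk̃-bridge d) (Walk̃-translate (Walk-faceWalk d)) Orb-refl (begin
        bridge d ++ translate (faceWalk M d)       ≈⟨ around-face ⟩
        faceWalk M̃ (corner d) ++ bridge d          ≈⟨ ph̃-delete [] (faceWalk M̃ (corner d)) (bridge d) (face (corner d))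
                                                         (Walk̃-++ (Walk̃-faceWalk (corner d)) (Walk̃-bridge d)) ⟩
        bridge d                                   ≡⟨ sym (++-identityʳ (bridge d)) ⟩
        bridge d ++ []                             ∎)
      where
      open Reasoning (PH̃-setoid (corner d) (rep d))
      around-face : PH̃ (corner d) (rep d) (bridge d ++ translate (faceWalk M d)) (faceWalk M̃ (corner d) ++ bridge d)
      around-face = subst₂ (λ x y → PH̃ (corner d) (rep y) (bridge d ++ translate (faceWalk M d))
                                                        (faceWalkUpTõ (corner d) x ++ bridge y))
        (sym (faceDeg-M̃-corner d)) (PermutationOrbits.iter-orbitSize (Walks.φ-perm M σ-perm α-invol) d)
        (ph-translate-faceWalkUpTo (faceDeg M d))

  suffix-prefix-cancelling : ∀ e → Cancelling̃ (suffix e ++ prefix (α M e))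
  suffix-prefix-cancelling e with leftView (α M e)
  ... | left j l   = inj₂ (link ε j , cong₂ _++_ (suffix-Left l) (prefix-Left l))
  ... | notLeft nl = inj₁ (cong₂ _++_ (suffix-notLeft nl) (prefix-notLeft nl))

  prefix-suffix-cancelling : ∀ e → Cancelling̃ (prefix e ++ suffix (α M e))
  prefix-suffix-cancelling e with leftView e
  ... | left i l   = inj₂ (α M (link ε i) , cong₂ _++_ (prefix-Left l)
          (trans (suffix-Left (subst (Left i) (sym (α-invol e)) l)) (cong (_∷ []) (sym (α-invol (link ε i))))))
  ... | notLeft nl = inj₁ (cong₂ _++_ (prefix-notLeft nl) (suffix-notLeft (λ i l → nl i (subst (Left i) (α-invol e) l))))

  translate-backtrack-shape : ∀ e → translate (e ∷ α M e ∷ []) ≡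
    (prefix e ++ e ∷ []) ++ (suffix e ++ prefix (α M e)) ++ α M e ∷ suffix (α M e)
  translate-backtrack-shape e = begin
    (P ++ e ∷ S) ++ (P′ ++ α M e ∷ S′) ++ []     ≡⟨ cong ((P ++ e ∷ S) ++_) (++-identityʳ _) ⟩
    (P ++ e ∷ S) ++ P′ ++ α M e ∷ S′             ≡⟨ ++-assoc P (e ∷ S) _ ⟩
    P ++ e ∷ S ++ P′ ++ α M e ∷ S′               ≡⟨ cong (λ z → P ++ e ∷ z) (sym (++-assoc S P′ _)) ⟩
    P ++ e ∷ (S ++ P′) ++ α M e ∷ S′             ≡⟨ sym (++-assoc P (e ∷ []) _) ⟩
    (P ++ e ∷ []) ++ (S ++ P′) ++ α M e ∷ S′     ∎
    where
    open ≡-Reasoning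
    P = prefix e
    S = suffix e
    P′ = prefix (α M e)
    S′ = suffix (α M e)

  ph-translate-backtrack : ∀ e {a b} → Walk̃ a (translate (e ∷ α M e ∷ [])) b → PH̃ a b (translate (e ∷ α M e ∷ [])) []
  ph-translate-backtrack e {a} {b} w = begin
    translate (e ∷ α M e ∷ [])                 ≡⟨ shape ⟩
    (P ++ e ∷ []) ++ (S ++ P′) ++ α M e ∷ S′   ≈⟨ proj₁ step₁ ⟩
    (P ++ e ∷ []) ++ α M e ∷ S′                ≡⟨ ++-assoc P (e ∷ []) (α M e ∷ S′) ⟩
    P ++ (e ∷ α M e ∷ []) ++ S′                ≈⟨ proj₁ step₂ ⟩
    P ++ S′                                     ≡⟨ sym (++-identityʳ (P ++ S′)) ⟩
    (P ++ S′) ++ []                             ≈⟨ proj₁ step₃ ⟩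
    []                                          ∎
    where
    open Reasoning (PH̃-setoid a b)
    P = prefix e
    S = suffix e
    P′ = prefix (α M e)
    S′ = suffix (α M e)
    shape = translate-backtrack-shape e
    step₁ = ph̃-cancel (P ++ e ∷ []) (α M e ∷ S′) (suffix-prefix-cancelling e) (Walk̃-≡ shape w)
    step₂ = ph̃-cancel P S′ (inj₂ (e , refl)) (Walk̃-≡ (++-assoc P (e ∷ []) (α M e ∷ S′)) (proj₂ step₁))
    step₃ = ph̃-cancel [] [] (prefix-suffix-cancelling e) (Walk̃-≡ (sym (++-identityʳ (P ++ S′))) (proj₂ step₂))

  ph-translate-elementary : ∀ {X a b} → Elementary M X → Walk a X b → PH̃ (rep a) (rep b) (translate X) []
  ph-translate-elementary (backtrack e) w = ph-translate-backtrack e (Walk̃-translate {w = e ∷ α M e ∷ []} w)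
  ph-translate-elementary (face d) w = case Walk-sameDarts (faceWalk M d) w (Walk-faceWalk d) of λ where
    (inj₁ empty)       → ph̃-≡ (cong translate empty)
    (inj₂ (a∼d , d∼b)) → ph̃-moveEnds (ph-translate-faceWalk d) (rep-Orb a∼d) (rep-Orb d∼b)

  translate-delete : ∀ s w₁ X w₂ → Elementary M X → Walk s (w₁ ++ X ++ w₂) s →
    Homotopic M̃ (translate (w₁ ++ X ++ w₂)) (translate (w₁ ++ w₂))
  translate-delete s w₁ X w₂ e w with Walk-split w₁ w
  ... | _ , w-w₁ , w′ with Walk-split X w′
  ... | _ , w-X , w-w₂ = subst₂ (Homotopic M̃) (sym translate-++₃) (sym (translate-++ w₁ w₂))
        (PH̃⇒Homotopic (ph̃-wrap (ph-translate-elementary e w-X) (Walk̃-translate w-w₁) (Walk̃-translate w-w₂)))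
    where
    translate-++₃ : translate (w₁ ++ X ++ w₂) ≡ translate w₁ ++ translate X ++ translate w₂
    translate-++₃ = trans (translate-++ w₁ (X ++ w₂)) (cong (translate w₁ ++_) (translate-++ X w₂))

  translate-HStep : ∀ {u v} → HStep M u v → Homotopic M̃ (translate u) (translate v)
  translate-HStep (delete (x ∷ w₁) X       w₂ e cp) = translate-delete x (x ∷ w₁) X w₂ e (ClosedPath⇒Walk cp)
  translate-HStep (delete []       (x ∷ X) w₂ e cp) = translate-delete x [] (x ∷ X) w₂ e (ClosedPath⇒Walk cp)
  translate-HStep (delete []       []      w₂ e cp) = h-refl

  translate-Homotopic : ∀ {u v} → Homotopic M u v → Homotopic M̃ (translate u) (translate v)
  translate-Homotopic (h-step s)     = translate-HStep s
  translate-Homotopic h-refl         = h-refl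
  translate-Homotopic (h-sym h)      = h-sym (translate-Homotopic h)
  translate-Homotopic (h-trans h h') = h-trans (translate-Homotopic h) (translate-Homotopic h')

  translate-loop : ∀ is → translate (map out is) ≡ map out is
  translate-loop []       = refl
  translate-loop (i ∷ is) = cong₂ (λ p s → (p ++ out i ∷ s) ++ translate (map out is))
      (prefix-notLeft (λ j l → Left⇒notOut l i refl))
      (suffix-notLeft (λ j l → Left⇒notInn l (shift plus i) (sym (α-out i))))
    ⟨ trans ⟩ cong (out i ∷_) (translate-loop is)

  translate-contraction : Homotopic M (loopList γ) [] → Homotopic M̃ (loopList γ) []
  translate-contraction h = subst (λ z → Homotopic M̃ z []) (translate-loop (allFin (suc n))) (translate-Homotopic h)

-- Noncontractibility and the theorem

module Transport {D : ℕ} {m₁ m₂ : RawMap D} (σ-cong : ∀ d → σ m₁ d ≡ σ m₂ d) (α-cong : ∀ d → α m₁ d ≡ α m₂ d) where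

  φ-cong : ∀ d → φ m₁ d ≡ φ m₂ d
  φ-cong d = trans (cong (α m₁) (σ-cong d)) (α-cong _)

  SameVertex-transport : ∀ {a b} → SameVertex m₁ a b → SameVertex m₂ a b
  SameVertex-transport {a} (j , e) = j , trans (sym (iter-cong σ-cong j a)) e

  Chain-transport : ∀ xs → Chain m₁ xs → Chain m₂ xs
  Chain-transport []           c       = tt
  Chain-transport (x ∷ [])     c       = tt
  Chain-transport (x ∷ y ∷ ys) (s , c) =
    subst (λ z → SameVertex m₂ z y) (α-cong x) (SameVertex-transport s) , Chain-transport (y ∷ ys) c

  ClosedPath-transport : ∀ xs → ClosedPath m₁ xs → ClosedPath m₂ xs
  ClosedPath-transport []       c       = tt
  ClosedPath-transport (x ∷ xs) (c , s) =
    Chain-transport (x ∷ xs) c , subst (λ z → SameVertex m₂ z x) (α-cong _) (SameVertex-transport s)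

  faceWalk-cong : ∀ d → faceWalk m₁ d ≡ faceWalk m₂ d
  faceWalk-cong d = trans (map-cong (λ j → trans (σ-cong _) (cong (σ m₂) (iter-cong φ-cong j d))) (upTo (faceDeg m₁ d)))
                          (cong (λ k → map (λ j → σ m₂ (iter (φ m₂) j d)) (upTo k)) (orbitSize-cong φ-cong d))

  Elementary-transport : ∀ {X} → Elementary m₁ X → Elementary m₂ X
  Elementary-transport (backtrack e) = subst (λ z → Elementary m₂ (e ∷ z ∷ [])) (sym (α-cong e)) (backtrack e)
  Elementary-transport (face d)      = subst (Elementary m₂) (sym (faceWalk-cong d)) (face d)

  Homotopic-transport : ∀ {u v} → Homotopic m₁ u v → Homotopic m₂ u v
  Homotopic-transport (h-step (delete w₁ X w₂ el cp)) =
    h-step (delete w₁ X w₂ (Elementary-transport el) (ClosedPath-transport _ cp))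
  Homotopic-transport h-refl         = h-refl
  Homotopic-transport (h-sym h)      = h-sym (Homotopic-transport h)
  Homotopic-transport (h-trans h h') = h-trans (Homotopic-transport h) (Homotopic-transport h')

+2-%-≢ : ∀ i n → (i + 2) % suc (suc (suc n)) ≢ i
+2-%-≢ i n e = 2≢q*k ((i + 2) / k) (+-cancelˡ-≡ i 2 _ (trans (m≡m%n+[m/n]*n (i + 2) k) (cong (_+ (i + 2) / k * k) e)))
  where
  k = suc (suc (suc n))
  2≢q*k : ∀ q → 2 ≢ q * k
  2≢q*k (suc q) 2≡ with ≤-trans (m≤m+n k (q * k)) (≤-reflexive (sym 2≡))
  ... | s≤s (s≤s ())

shift-minus≡shift-plus⇒k≡1 : ∀ {k} (i : Fin (suc k)) → shift minus i ≢ i → shift minus i ≡ shift plus i → k ≡ 1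
shift-minus≡shift-plus⇒k≡1 {zero}              Fin.zero i-1≢i _ = ⊥-elim (i-1≢i refl)
shift-minus≡shift-plus⇒k≡1 {suc zero}          i        _     _ = refl
shift-minus≡shift-plus⇒k≡1 {suc (suc k)}       i        _     e = ⊥-elim (+2-%-≢ (toℕ i) k (sym (begin
  toℕ i                          ≡⟨ cong toℕ (sym (shift-neg-shift plus i)) ⟩
  toℕ (shift plus (shift minus i)) ≡⟨ cong (toℕ ∘ shift plus) e ⟩
  toℕ (shift plus (shift plus i))  ≡⟨ toℕ-shift-shift plus plus i ⟩
  (toℕ i + 2) % suc (suc (suc k))  ∎)))
  where open ≡-Reasoning

module _ {D : ℕ} {m : RawMap D} (α-invol : ∀ d → α m (α m d) ≡ d) where

  Homotopic-backtrack : ∀ e → Homotopic m (e ∷ α m e ∷ []) []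
  Homotopic-backtrack e = h-step (delete [] (e ∷ α m e ∷ []) [] (backtrack e) (((0 , refl) , tt) , (0 , α-invol e)))

  twoDartLoop-contractible : ∀ k (f : Fin (suc k) → Fin D) → k ≡ 1 → ∀ i → α m (f (shift minus i)) ≡ f i →
    Homotopic m (map f (allFin (suc k))) []
  twoDartLoop-contractible _ f refl Fin.zero e =
    subst (λ z → Homotopic m (z ∷ f (Fin.suc Fin.zero) ∷ []) []) e
      (subst (λ z → Homotopic m (α m (f (Fin.suc Fin.zero)) ∷ z ∷ []) []) (α-invol _) (Homotopic-backtrack _))
  twoDartLoop-contractible _ f refl (Fin.suc Fin.zero) e =
    subst (λ z → Homotopic m (f Fin.zero ∷ z ∷ []) []) e (Homotopic-backtrack _)

-- If γ left a vertex along the dart it arrived by, simplicity would force γ to be the backtrack (γ₁, γ₁⁻¹).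
noncontractible⇒inn≢out : {D : ℕ} {m : RawMap D} {γ : Loop D} (ε : Sign) → IsMap m → IsLoop m γ → IsSimple m γ →
  Noncontractible m γ → ∀ i j → Reglue.inn m γ ε i ≢ Reglue.out m γ ε j
noncontractible⇒inn≢out {m = m} {γ} ε isMap loop simple nc i j inn≡out =
  nc (twoDartLoop-contractible α-invol (len γ) (darts γ) (shift-minus≡shift-plus⇒k≡1 i i-1≢i i-1≡i+1) i α-out-prev)
  where
  open IsMap isMap
  open Reglue m γ ε
  Orb-inn-out : Orb (σ m) (inn i) (out i)
  Orb-inn-out = subst (λ z → Orb (σ m) (inn i) (out z)) (shift-neg-shift plus i) (loop (shift minus i))
  α-out-prev : α m (out (shift minus i)) ≡ out i
  α-out-prev = subst (λ z → inn i ≡ out z) (simple j i (subst (λ z → Orb (σ m) z (out i)) inn≡out Orb-inn-out)) inn≡out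
  α-out : α m (out i) ≡ out (shift minus i)
  α-out = trans (cong (α m) (sym α-out-prev)) (α-invol _)
  i-1≡i+1 : shift minus i ≡ shift plus i
  i-1≡i+1 = simple _ _ (subst (λ z → Orb (σ m) z (out (shift plus i))) α-out (loop i))
  i-1≢i : shift minus i ≢ i
  i-1≢i i-1≡i = α-fpf (out i) (trans α-out (cong out i-1≡i))

proposition2 : (g : ℕ) → 1 ≤ g → {D : ℕ} (x : Triple D) → ValidTriple g x →
    ValidTriple g (Φ x)
    × TripleIso (Φ (Φ x)) x
    × numEdges (tmap (Φ x)) ≡ numEdges (tmap x)
    × (∀ d e → SameFace (tmap x) d e ⇔ SameFace (tmap (Φ x)) (ρ x d) (ρ x e))
    × (∀ d → faceDeg (tmap (Φ x)) (ρ x d) ≡ faceDeg (tmap x) d)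
proposition2 g _ ⟨ M , γ , ε ⟩ ((isMap , genus , even) , loop , simple , noncontractible) =
  ((IsMap-M̃ , genus̃ , eveñ) , IsLoop-M̃ , IsSimple-M̃ , noncontractiblẽ) ,
  Φ-involutive , refl , SameFace-cornerMap⇔ , faceDeg-M̃-cornerMap
  where
  inn≢out = noncontractible⇒inn≢out ε isMap loop simple noncontractible
  open Reglued M γ ε isMap loop simple inn≢out

  genus̃ : HasGenus M̃ g
  genus̃ = trans (cong₂ (λ v f → v + f + 2 * g) numVertices-M̃ numFaces-M̃) genus

  eveñ : ∀ d → 2 ∣ faceDeg M̃ d
  eveñ d = subst (2 ∣_) (sym (faceDeg-M̃ d)) (even _)

  -- Regluing M̃ along γ gives back M, so a contraction of γ in M̃ translates into one in M.
  noncontractiblẽ : Noncontractible M̃ γ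
  noncontractiblẽ contraction = noncontractible (Transport.Homotopic-transport Φσ-involutive (λ _ → refl)
    (Translation.translate-contraction M̃ γ (neg ε) IsMap-M̃ IsLoop-M̃ IsSimple-M̃ inn≢out contraction))
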